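{- Let $S=\{x_1,\dots,x_n\}$ be an LCM-closed set of distinct positive integers, indexed so that $x_i\mid x_j\Rightarrow i\le j$, and let $f$ be an arithmetical function. Then the LCM matrix $[S]_f=(f([x_i,x_j]))$ satisfies $$\det[S]_f=\prod_{v=1}^n\ \sum_{\substack{z:\ x_v\mid z\mid \mathrm{lcm}\,S\\ x_t\nmid z\ \text{for all } t>v}}[\zeta*(f_z\mu)]\Big(\frac{\mathrm{lcm}\,S}{z}\Big).$$
   Context: $S$ is LCM-closed if $[x_i,x_j]\in S$ for all $x_i,x_j\in S$, where $[a,b]$ is the least common multiple. $\mathrm{lcm}\,S=[x_1,\dots,x_n]$. For $a\in\mathbb{Z}^+$, $f_a$ is the arithmetical function $f_a(n)=f(an)$; $\mu$ is the number-theoretic Möbius function, $\zeta(n)=1$ for all $n$, $f_z\mu$ is the pointwise product, and $*$ is Dirichlet convolution, so $[\zeta*(f_z\mu)](N)=\sum_{a\mid N}f(za)\mu(a)$. -}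

module Defs where

open import Level using (Level)
open import Algebra.Bundles using (CommutativeRing)
open import Data.Nat using (ℕ; zero; suc; _*_; _/_)
open import Data.Nat.Divisibility using (_∣_; _∣?_)
open import Data.Nat.Primality using (Prime; prime?)
open import Data.Nat.LCM using (lcm)
open import Data.List using (List; []; _∷_; filter; foldr; map; length)
open import Data.Fin using (Fin; punchIn; toℕ; _<_; _≤_) renaming (zero to fzero; suc to fsuc)
open import Data.Product using (∃)
open import Relation.Nullary using (¬_; Dec; yes; no)
open import Relation.Nullary.Decidable using (¬?; _→-dec_)
open import Data.Fin.Properties using (all?; _<?_)
open import Relation.Binary.PropositionalEquality using (_≡_)

range1 : ℕ → List ℕ
range1 zero = []
range1 (suc n) = range1 n Data.List.++ (suc n ∷ [])

divisors : ℕ → List ℕ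
divisors N = filter (_∣? N) (range1 N)

-- natural-number division, with the convention N ÷ 0 = 0 (never used at 0 here)
_÷_ : ℕ → ℕ → ℕ
N ÷ zero = zero
N ÷ suc d = N / suc d

-- the list of d ∈ {2,…,n} with d² ∣ n ; n ≥ 1 is squarefree iff this list is empty
squarefreeList : ℕ → List ℕ
squarefreeList n = filter (λ d → d * d ∣? n) (filter (λ d → 2 Data.Nat.≤? d) (range1 n))

ω : ℕ → ℕ
ω n = length (filter prime? (divisors n))

module Arith {c ℓ : Level} (R : CommutativeRing c ℓ) where
  open CommutativeRing R renaming (_+_ to _⊕_; _*_ to _⊗_)

  sumL : List Carrier → Carrier
  sumL = foldr _⊕_ 0#

  ∏ : ∀ {n} → (Fin n → Carrier) → Carrier
  ∏ {zero} g = 1#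
  ∏ {suc n} g = g fzero ⊗ ∏ (λ i → g (fsuc i))

  ∑ : ∀ {n} → (Fin n → Carrier) → Carrier
  ∑ {zero} g = 0#
  ∑ {suc n} g = g fzero ⊕ ∑ (λ i → g (fsuc i))

  sgn : ℕ → Carrier
  sgn zero = 1#
  sgn (suc k) = - sgn k

  det : ∀ {n} → (Fin n → Fin n → Carrier) → Carrier
  det {zero} M = 1#
  det {suc n} M = ∑ (λ j → sgn (toℕ j) ⊗ (M fzero j ⊗
                     det (λ i k → M (fsuc i) (punchIn j k))))

  -- number-theoretic Möbius function: μ(n) = 0 if n is not squarefree,
  -- μ(n) = (-1)^ω(n) otherwise (n ≥ 1; μ(0) is irrelevant, set to 0)
  μ : ℕ → Carrier
  μ zero = 0#
  μ n@(suc _) with squarefreeList n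
  ... | [] = sgn (ω n)
  ... | _ ∷ _ = 0#

  ζ : ℕ → Carrier
  ζ _ = 1#

  _⋆_ : (ℕ → Carrier) → (ℕ → Carrier) → ℕ → Carrier
  (g ⋆ h) N = sumL (map (λ d → g d ⊗ h (N ÷ d)) (divisors N))

  -- f_a(n) = f(a n)
  shift : (ℕ → Carrier) → ℕ → ℕ → Carrier
  shift f a n = f (a * n)

  _·_ : (ℕ → Carrier) → (ℕ → Carrier) → ℕ → Carrier
  (g · h) n = g n ⊗ h n

lcmAll : ∀ {n} → (Fin n → ℕ) → ℕ
lcmAll {zero} x = 1
lcmAll {suc n} x = lcm (x fzero) (lcmAll (λ i → x (fsuc i)))

LCMClosed : ∀ {n} → (Fin n → ℕ) → Set
LCMClosed {n} x = ∀ i j → ∃ λ (k : Fin n) → x k ≡ lcm (x i) (x j)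

zsFor : ∀ {n} → (Fin n → ℕ) → Fin n → List ℕ
zsFor {n} x v = filter (λ z → x v ∣? z) (filter (λ z → noLater z) (divisors (lcmAll x)))
  where
  noLater : (z : ℕ) → Dec (∀ (t : Fin n) → v < t → ¬ (x t ∣ z))
  noLater z = all? (λ t → (v <? t) →-dec ¬? (x t ∣? z))

module Submission where

-- Let L = lcm S and g(z) = (ζ ⋆ (f_z μ))(L / z).  Call v the top index of a divisor k of L
-- if x_v ∣ k and x_t ∤ k for t > v; then h_v = Σ_{z ∈ zsFor x v} g(z) sums g over the
-- divisors whose top index is v.  The proof has three ingredients.
--  (1) Möbius inversion on the divisors of L:  Σ_{w ∣ z ∣ L} g(z) = f(w)  for w ∣ L.
--  (2) Factorisation: every k with [x_i, x_j] ∣ k ∣ L has a unique top index v, and by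
--      LCM-closedness x_i, x_j ∣ x_v; hence f([x_i, x_j]) = Σ_v E_iv h_v E_jv with
--      E_iv = [x_i ∣ x_v].
--  (3) Linear algebra: E is upper unitriangular (x_i ∣ x_v forces i ≤ v), so
--      det (E B) = det B, and B_vj = h_v E_jv is lower triangular with diagonal h_v.

open import Defs
open import Level using (Level; _⊔_)
open import Algebra.Bundles using (CommutativeRing)
open import Data.Nat using (ℕ; zero; suc; _≤_; z≤n; s≤s; _/_; NonZero; ≢-nonZero)
import Data.Nat as ℕ
import Data.Nat.Properties as ℕₚ
open import Data.Nat.Divisibility
open import Data.Nat.DivMod using (m*n/n≡m)
open import Data.Nat.LCM using (lcm; m∣lcm[m,n]; n∣lcm[m,n]; lcm-least; gcd*lcm)
open import Data.Nat.GCD using (gcd)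
open import Data.Nat.Primality using (Prime; prime?; prime⇒irreducible; euclidsLemma; ¬prime[1]; ¬prime[0])
open import Data.Nat.Primality.Factorisation using (factorise)
open import Data.Nat.Coprimality using (Coprime; coprime-divisor)
open import Data.Nat.ListAction using (product)
open import Data.Integer using (ℤ; +_)
import Data.Integer as ℤ
import Data.Integer.Properties as ℤₚ
open import Data.Fin using (Fin; punchIn; toℕ; _≟_; _<_; _<?_) renaming (zero to fzero; suc to fsuc)
import Data.Fin.Properties as Finₚ
open import Data.List using (List; []; _∷_; _++_; filter; map; length)
open import Data.List.Membership.Propositional using (_∈_)
open import Data.List.Membership.Propositional.Properties using (∈-++⁺ˡ; ∈-++⁺ʳ; ∈-++⁻; ∈-filter⁺; ∈-filter⁻)
open import Data.List.Relation.Unary.All using (_∷_)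
open import Data.List.Relation.Unary.Any using (here; there)
open import Data.List.Relation.Unary.Any.Properties using (¬Any[])
open import Data.Product using (∃; _×_; _,_; proj₁; proj₂)
open import Data.Sum using (_⊎_; inj₁; inj₂)
open import Data.Empty using (⊥-elim)
open import Relation.Nullary using (¬_; Dec; yes; no; ¬?)
open import Relation.Nullary.Decidable using (_→-dec_; _×-dec_)
open import Relation.Binary.PropositionalEquality using (_≡_; _≢_)
  renaming (refl to ≡-refl; cong to ≡-cong; sym to ≡-sym; trans to ≡-trans; subst to ≡-subst)

divisor-pos : ∀ {m n} → 1 ≤ n → m ∣ n → 1 ≤ m
divisor-pos {zero} {suc n} _ m∣n with () ← 0∣⇒≡0 m∣n
divisor-pos {suc m} _ _ = s≤s z≤n

divisor-≤ : ∀ {m n} → 1 ≤ n → m ∣ n → m ≤ n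
divisor-≤ {n = suc n} _ m∣n = ∣⇒≤ m∣n

∤-larger : ∀ {k n} → 1 ≤ n → n ℕ.< k → ¬ k ∣ n
∤-larger n≥1 n<k k∣n = ℕₚ.<⇒≱ n<k (divisor-≤ n≥1 k∣n)

÷-exact : ∀ {d q N} → 1 ≤ d → d ℕ.* q ≡ N → N ÷ d ≡ q
÷-exact {suc d} {q} _ ≡-refl = ≡-trans (≡-cong (_/ suc d) (ℕₚ.*-comm (suc d) q)) (m*n/n≡m q (suc d))

module _ {d N : ℕ} (d≥1 : 1 ≤ d) (d∣N : d ∣ N) where

  ÷-cancel : d ℕ.* (N ÷ d) ≡ N
  ÷-cancel = ≡-trans (≡-cong (d ℕ.*_) (÷-exact d≥1 d*q≡N)) d*q≡N
    where d*q≡N : d ℕ.* quotient d∣N ≡ N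
          d*q≡N = ≡-sym (m∣n⇒n≡m*quotient d∣N)

  ÷-divides : N ÷ d ∣ N
  ÷-divides = divides d (≡-sym ÷-cancel)

  ÷-pos : 1 ≤ N → 1 ≤ N ÷ d
  ÷-pos N≥1 = divisor-pos N≥1 ÷-divides

range1-∈⁺ : ∀ {k n} → 1 ≤ k → k ≤ n → k ∈ range1 n
range1-∈⁺ {suc k} {zero} _ ()
range1-∈⁺ {k} {suc n} k≥1 k≤1+n with k ℕ.≟ suc n
... | yes ≡-refl = ∈-++⁺ʳ (range1 n) (here ≡-refl)
... | no k≢1+n = ∈-++⁺ˡ (range1-∈⁺ k≥1 (ℕₚ.≤-pred (ℕₚ.≤∧≢⇒< k≤1+n k≢1+n)))

range1-∈⁻ : ∀ {k n} → k ∈ range1 n → 1 ≤ k × k ≤ n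
range1-∈⁻ {k} {suc n} k∈ with ∈-++⁻ (range1 n) k∈
... | inj₁ k∈′ = proj₁ (range1-∈⁻ {n = n} k∈′) , ℕₚ.m≤n⇒m≤1+n (proj₂ (range1-∈⁻ {n = n} k∈′))
... | inj₂ (here ≡-refl) = s≤s z≤n , ℕₚ.≤-refl

prime≥2 : ∀ {p} → Prime p → 2 ≤ p
prime≥2 {zero} pp = ⊥-elim (¬prime[0] pp)
prime≥2 {suc zero} pp = ⊥-elim (¬prime[1] pp)
prime≥2 {suc (suc p)} _ = s≤s (s≤s z≤n)

primeFactor : ∀ m → 2 ≤ m → ∃ λ p → Prime p × p ∣ m
primeFactor (suc zero) (s≤s ())
primeFactor (suc (suc m)) _ with factorise (suc (suc m))
... | record { factors = [] ; isFactorisation = () }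
... | record { factors = p ∷ ps ; isFactorisation = e ; factorsPrime = pp ∷ _ } =
      p , pp , divides (product ps) (≡-trans e (ℕₚ.*-comm p (product ps)))

prime∣prime : ∀ {q p} → Prime q → Prime p → q ∣ p → q ≡ p
prime∣prime qq pp q∣p with prime⇒irreducible pp q∣p
... | inj₁ ≡-refl = ⊥-elim (¬prime[1] qq)
... | inj₂ q≡p = q≡p

coprime-prime : ∀ {k p} → Prime p → ¬ (p ∣ k) → Coprime k p
coprime-prime pp p∤k (d∣k , d∣p) with prime⇒irreducible pp d∣p
... | inj₁ d≡1 = d≡1
... | inj₂ ≡-refl = ⊥-elim (p∤k d∣k)

coprime-square : ∀ {q p} → Prime q → Prime p → q ≢ p → Coprime (q ℕ.* q) p
coprime-square {q} qq pp q≢p (d∣qq , d∣p) with prime⇒irreducible pp d∣p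
... | inj₁ d≡1 = d≡1
... | inj₂ ≡-refl with euclidsLemma q q pp d∣qq
...   | inj₁ p∣q = ⊥-elim (q≢p (≡-sym (prime∣prime pp qq p∣q)))
...   | inj₂ p∣q = ⊥-elim (q≢p (≡-sym (prime∣prime pp qq p∣q)))

lcm-pos : ∀ {a b} → 1 ≤ a → 1 ≤ b → 1 ≤ lcm a b
lcm-pos {suc a} {suc b} _ _ = positive (lcm (suc a) (suc b)) (gcd*lcm (suc a) (suc b))
  where
  positive : ∀ l → gcd (suc a) (suc b) ℕ.* l ≡ suc a ℕ.* suc b → 1 ≤ l
  positive zero e with () ← ≡-trans (≡-sym (ℕₚ.*-zeroʳ (gcd (suc a) (suc b)))) e
  positive (suc l) _ = s≤s z≤n

lcmAll-pos : ∀ {n} (x : Fin n → ℕ) → (∀ i → 1 ≤ x i) → 1 ≤ lcmAll x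
lcmAll-pos {zero} x _ = s≤s z≤n
lcmAll-pos {suc n} x pos = lcm-pos (pos fzero) (lcmAll-pos (λ i → x (fsuc i)) (λ i → pos (fsuc i)))

∣lcmAll : ∀ {n} (x : Fin n → ℕ) i → x i ∣ lcmAll x
∣lcmAll {suc n} x fzero = m∣lcm[m,n] _ _
∣lcmAll {suc n} x (fsuc i) = ∣-trans (∣lcmAll (λ i → x (fsuc i)) i) (n∣lcm[m,n] (x fzero) _)

largestWitness : ∀ {n} {P : Fin n → Set} → (∀ t → Dec (P t)) → ∀ i → P i →
                 ∃ λ v → P v × (∀ t → v < t → ¬ P t)
largestWitness {suc n} P? i Pi with Finₚ.any? (λ t → P? (fsuc t))
... | yes (t , Pt) with largestWitness (λ t → P? (fsuc t)) t Pt
...   | v , Pv , above = fsuc v , Pv , λ { fzero () ; (fsuc t) (s≤s v<t) → above t v<t }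
largestWitness {suc n} P? fzero Pi | no none = fzero , Pi , λ { fzero () ; (fsuc t) _ Pt → none (t , Pt) }
largestWitness {suc n} P? (fsuc i) Pi | no none = ⊥-elim (none (i , Pi))

module FiniteSums {c ℓ : Level} (R : CommutativeRing c ℓ) where
  open CommutativeRing R hiding (zero)
  open Arith R
  open import Algebra.Solver.Ring.NaturalCoefficients.Default commutativeSemiring
  open import Relation.Binary.Reasoning.Setoid setoid
  open import Algebra.Properties.Ring ring using (-0#≈0#; -‿+-comm)

  ≡⇒≈ : ∀ {a b} → a ≡ b → a ≈ b
  ≡⇒≈ ≡-refl = refl

  𝟙 : ∀ {p} {P : Set p} → Dec P → Carrier
  𝟙 (yes _) = 1#
  𝟙 (no _) = 0#

  𝟙-yes : ∀ {p} {P : Set p} (d : Dec P) → P → 𝟙 d ≈ 1#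
  𝟙-yes (yes _) _ = refl
  𝟙-yes (no ¬P) P = ⊥-elim (¬P P)

  𝟙-no : ∀ {p} {P : Set p} (d : Dec P) → ¬ P → 𝟙 d ≈ 0#
  𝟙-no (yes P) ¬P = ⊥-elim (¬P P)
  𝟙-no (no _) _ = refl

  𝟙-no-* : ∀ {p} {P : Set p} (d : Dec P) {a} → ¬ P → 𝟙 d * a ≈ 0#
  𝟙-no-* d ¬P = trans (*-congʳ (𝟙-no d ¬P)) (zeroˡ _)

  𝟙-yes-* : ∀ {p} {P : Set p} (d : Dec P) {a} → P → 𝟙 d * a ≈ a
  𝟙-yes-* d P = trans (*-congʳ (𝟙-yes d P)) (*-identityˡ _)

  𝟙-guard : ∀ {p} {P : Set p} (d : Dec P) {a b} → (P → a ≈ b) → 𝟙 d * a ≈ 𝟙 d * b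
  𝟙-guard (yes P) a≈b = *-congˡ (a≈b P)
  𝟙-guard (no _) _ = trans (zeroˡ _) (sym (zeroˡ _))

  𝟙-⇔ : ∀ {p q} {P : Set p} {Q : Set q} (d : Dec P) (e : Dec Q) → (P → Q) → (Q → P) → 𝟙 d ≈ 𝟙 e
  𝟙-⇔ (yes _) (yes _) _ _ = refl
  𝟙-⇔ (no _) (no _) _ _ = refl
  𝟙-⇔ (yes P) (no ¬Q) P⇒Q _ = ⊥-elim (¬Q (P⇒Q P))
  𝟙-⇔ (no ¬P) (yes Q) _ Q⇒P = ⊥-elim (¬P (Q⇒P Q))

  𝟙-complement : ∀ {p} {P : Set p} (d : Dec P) → 𝟙 d + 𝟙 (¬? d) ≈ 1#
  𝟙-complement (yes _) = +-identityʳ 1#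
  𝟙-complement (no _) = +-identityˡ 1#

  𝟙-× : ∀ {p q} {P : Set p} {Q : Set q} (d : Dec P) (e : Dec Q) → 𝟙 (d ×-dec e) ≈ 𝟙 d * 𝟙 e
  𝟙-× (yes _) (yes _) = sym (*-identityˡ 1#)
  𝟙-× (yes _) (no _) = sym (*-identityˡ 0#)
  𝟙-× (no _) _ = sym (zeroˡ _)

  -- The lemmas are stated for an opaque copy of ∑: Agda would otherwise
  -- unfold ∑ at successor sizes and could not infer the summands when lemmas are applied;
  -- sumFin≈∑ converts at the interface with det, which is defined through ∑.
  opaque
    sumFin : ∀ {n} → (Fin n → Carrier) → Carrier
    sumFin = ∑

    sumFin≈∑ : ∀ {n} (f : Fin n → Carrier) → sumFin f ≈ ∑ f
    sumFin≈∑ _ = refl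

    sumFin-suc : ∀ {n} (f : Fin (suc n) → Carrier) → sumFin f ≈ f fzero + sumFin (λ i → f (fsuc i))
    sumFin-suc _ = refl

    sumFin-empty : (f : Fin zero → Carrier) → sumFin f ≈ 0#
    sumFin-empty _ = refl

    sumFin-cong : ∀ {n} {f g : Fin n → Carrier} → (∀ i → f i ≈ g i) → sumFin f ≈ sumFin g
    sumFin-cong {zero} _ = refl
    sumFin-cong {suc n} f≈g = +-cong (f≈g fzero) (sumFin-cong (λ i → f≈g (fsuc i)))

    sumFin-zero : ∀ {n} {f : Fin n → Carrier} → (∀ i → f i ≈ 0#) → sumFin f ≈ 0#
    sumFin-zero {zero} _ = refl
    sumFin-zero {suc n} f≈0 = trans (+-cong (f≈0 fzero) (sumFin-zero (λ i → f≈0 (fsuc i)))) (+-identityˡ 0#)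

    sumFin-+ : ∀ {n} (f g : Fin n → Carrier) → sumFin (λ i → f i + g i) ≈ sumFin f + sumFin g
    sumFin-+ {zero} _ _ = sym (+-identityˡ 0#)
    sumFin-+ {suc n} f g = trans (+-congˡ (sumFin-+ (λ i → f (fsuc i)) (λ i → g (fsuc i))))
      (solve 4 (λ a b c d → (a :+ b) :+ (c :+ d) := (a :+ c) :+ (b :+ d)) refl
         (f fzero) (g fzero) (∑ (λ i → f (fsuc i))) (∑ (λ i → g (fsuc i))))

    sumFin-*ˡ : ∀ {n} (a : Carrier) (f : Fin n → Carrier) → sumFin (λ i → a * f i) ≈ a * sumFin f
    sumFin-*ˡ {zero} a _ = sym (zeroʳ a)
    sumFin-*ˡ {suc n} a f = trans (+-congˡ (sumFin-*ˡ a (λ i → f (fsuc i)))) (sym (distribˡ a (f fzero) _))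

    sumFin-neg : ∀ {n} (f : Fin n → Carrier) → sumFin (λ i → - f i) ≈ - sumFin f
    sumFin-neg {zero} _ = sym -0#≈0#
    sumFin-neg {suc n} f = trans (+-congˡ (sumFin-neg (λ i → f (fsuc i)))) (-‿+-comm (f fzero) _)

    sumFin-single : ∀ {n} (f : Fin n → Carrier) (i₀ : Fin n) → (∀ i → i ≢ i₀ → f i ≈ 0#) → sumFin f ≈ f i₀
    sumFin-single {suc n} f fzero others = trans (+-congˡ (sumFin-zero (λ i → others (fsuc i) (λ ())))) (+-identityʳ _)
    sumFin-single {suc n} f (fsuc i₀) others =
      trans (+-cong (others fzero (λ ())) (sumFin-single (λ i → f (fsuc i)) i₀ (λ i i≢i₀ → others (fsuc i) (λ e → i≢i₀ (Finₚ.suc-injective e)))))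
            (+-identityˡ _)

    sumFin-swap : ∀ {m n} (F : Fin m → Fin n → Carrier) → sumFin (λ i → sumFin (F i)) ≈ sumFin (λ j → sumFin (λ i → F i j))
    sumFin-swap {zero} {n} F = sym (sumFin-zero {n} (λ _ → refl))
    sumFin-swap {suc m} F = trans (+-congˡ (sumFin-swap (λ i → F (fsuc i)))) (sym (sumFin-+ (F fzero) _))

  ∏-cong : ∀ {n} {f g : Fin n → Carrier} → (∀ i → f i ≈ g i) → ∏ f ≈ ∏ g
  ∏-cong {zero} _ = refl
  ∏-cong {suc n} f≈g = *-cong (f≈g fzero) (∏-cong (λ i → f≈g (fsuc i)))

  sumOver : List ℕ → (ℕ → Carrier) → Carrier
  sumOver l g = sumL (map g l)

  sumOver-cong : ∀ l {g h : ℕ → Carrier} → (∀ k → k ∈ l → g k ≈ h k) → sumOver l g ≈ sumOver l h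
  sumOver-cong [] _ = refl
  sumOver-cong (k ∷ l) g≈h = +-cong (g≈h k (here ≡-refl)) (sumOver-cong l (λ k′ k′∈l → g≈h k′ (there k′∈l)))

  sumOver-zero : ∀ l {g : ℕ → Carrier} → (∀ k → k ∈ l → g k ≈ 0#) → sumOver l g ≈ 0#
  sumOver-zero [] _ = refl
  sumOver-zero (k ∷ l) g≈0 = trans (+-cong (g≈0 k (here ≡-refl)) (sumOver-zero l (λ k′ k′∈l → g≈0 k′ (there k′∈l)))) (+-identityˡ 0#)

  sumOver-+ : ∀ l (g h : ℕ → Carrier) → sumOver l (λ k → g k + h k) ≈ sumOver l g + sumOver l h
  sumOver-+ [] _ _ = sym (+-identityˡ 0#)
  sumOver-+ (k ∷ l) g h = trans (+-congˡ (sumOver-+ l g h))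
    (solve 4 (λ a b c d → (a :+ b) :+ (c :+ d) := (a :+ c) :+ (b :+ d)) refl (g k) (h k) (sumOver l g) (sumOver l h))

  sumOver-*ˡ : ∀ l (a : Carrier) (g : ℕ → Carrier) → sumOver l (λ k → a * g k) ≈ a * sumOver l g
  sumOver-*ˡ [] a _ = sym (zeroʳ a)
  sumOver-*ˡ (k ∷ l) a g = trans (+-congˡ (sumOver-*ˡ l a g)) (sym (distribˡ a (g k) _))

  sumOver-++ : ∀ l₁ l₂ (g : ℕ → Carrier) → sumOver (l₁ ++ l₂) g ≈ sumOver l₁ g + sumOver l₂ g
  sumOver-++ [] _ _ = sym (+-identityˡ _)
  sumOver-++ (k ∷ l₁) l₂ g = trans (+-congˡ (sumOver-++ l₁ l₂ g)) (sym (+-assoc _ _ _))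

  sumOver-filter : ∀ {p} {P : ℕ → Set p} (P? : ∀ k → Dec (P k)) l (g : ℕ → Carrier) →
                   sumOver (filter P? l) g ≈ sumOver l (λ k → 𝟙 (P? k) * g k)
  sumOver-filter P? [] _ = refl
  sumOver-filter P? (k ∷ l) g with P? k
  ... | yes _ = +-cong (sym (*-identityˡ _)) (sumOver-filter P? l g)
  ... | no _ = trans (sumOver-filter P? l g) (sym (trans (+-congʳ (zeroˡ _)) (+-identityˡ _)))

  sumOver-sumFin : ∀ l {n} (F : Fin n → ℕ → Carrier) → sumOver l (λ k → sumFin (λ v → F v k)) ≈ sumFin (λ v → sumOver l (F v))
  sumOver-sumFin [] {n} _ = sym (sumFin-zero {n} (λ _ → refl))
  sumOver-sumFin (k ∷ l) F = trans (+-congˡ (sumOver-sumFin l F)) (sym (sumFin-+ (λ v → F v k) (λ v → sumOver l (F v))))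

  sumOver-swap : ∀ l₁ l₂ (F : ℕ → ℕ → Carrier) →
                 sumOver l₁ (λ a → sumOver l₂ (F a)) ≈ sumOver l₂ (λ b → sumOver l₁ (λ a → F a b))
  sumOver-swap [] l₂ _ = sym (sumOver-zero l₂ (λ _ _ → refl))
  sumOver-swap (k ∷ l₁) l₂ F = trans (+-congˡ (sumOver-swap l₁ l₂ F)) (sym (sumOver-+ l₂ (F k) _))

  sumTo : ℕ → (ℕ → Carrier) → Carrier
  sumTo N g = sumOver (range1 N) g

  sumTo-suc : ∀ N g → sumTo (suc N) g ≈ sumTo N g + g (suc N)
  sumTo-suc N g = trans (sumOver-++ (range1 N) (suc N ∷ []) g) (+-congˡ (+-identityʳ _))

  sumTo-cong : ∀ N {g h : ℕ → Carrier} → (∀ k → 1 ≤ k → k ≤ N → g k ≈ h k) → sumTo N g ≈ sumTo N h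
  sumTo-cong N g≈h = sumOver-cong (range1 N) (λ k k∈ → g≈h k (proj₁ (range1-∈⁻ {n = N} k∈)) (proj₂ (range1-∈⁻ {n = N} k∈)))

  sumTo-+ : ∀ a b (g : ℕ → Carrier) → sumTo (a ℕ.+ b) g ≈ sumTo a g + sumTo b (λ k → g (a ℕ.+ k))
  sumTo-+ a zero g = trans (≡⇒≈ (≡-cong (λ t → sumTo t g) (ℕₚ.+-identityʳ a))) (sym (+-identityʳ _))
  sumTo-+ a (suc b) g =
    begin
      sumTo (a ℕ.+ suc b) g                                     ≈⟨ ≡⇒≈ (≡-cong (λ t → sumTo t g) (ℕₚ.+-suc a b)) ⟩
      sumTo (suc (a ℕ.+ b)) g                                   ≈⟨ sumTo-suc (a ℕ.+ b) g ⟩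
      sumTo (a ℕ.+ b) g + g (suc (a ℕ.+ b))                     ≈⟨ +-cong (sumTo-+ a b g) (≡⇒≈ (≡-cong g (≡-sym (ℕₚ.+-suc a b)))) ⟩
      (sumTo a g + sumTo b (λ k → g (a ℕ.+ k))) + g (a ℕ.+ suc b) ≈⟨ +-assoc _ _ _ ⟩
      sumTo a g + (sumTo b (λ k → g (a ℕ.+ k)) + g (a ℕ.+ suc b)) ≈⟨ +-congˡ (sym (sumTo-suc b (λ k → g (a ℕ.+ k)))) ⟩
      sumTo a g + sumTo (suc b) (λ k → g (a ℕ.+ k))             ∎

  sumTo-truncate : ∀ y L {g : ℕ → Carrier} → y ≤ L → (∀ k → y ℕ.< k → k ≤ L → g k ≈ 0#) → sumTo L g ≈ sumTo y g
  sumTo-truncate y zero z≤n _ = refl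
  sumTo-truncate y (suc L) {g} y≤1+L vanish with y ℕ.≟ suc L
  ... | yes ≡-refl = refl
  ... | no y≢1+L = trans (sumTo-suc L g)
                     (trans (+-cong (sumTo-truncate y L y≤L (λ k y<k k≤L → vanish k y<k (ℕₚ.m≤n⇒m≤1+n k≤L)))
                                    (vanish (suc L) (s≤s y≤L) ℕₚ.≤-refl))
                            (+-identityʳ _))
    where y≤L : y ≤ L
          y≤L = ℕₚ.≤-pred (ℕₚ.≤∧≢⇒< y≤1+L y≢1+L)

  sumTo-zero : ∀ N {g : ℕ → Carrier} → (∀ k → 1 ≤ k → k ≤ N → g k ≈ 0#) → sumTo N g ≈ 0#
  sumTo-zero N g≈0 = sumOver-zero (range1 N) (λ k k∈ → g≈0 k (proj₁ (range1-∈⁻ {n = N} k∈)) (proj₂ (range1-∈⁻ {n = N} k∈)))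

  sumTo-single : ∀ N c {g : ℕ → Carrier} → 1 ≤ c → c ≤ N →
                 (∀ k → 1 ≤ k → k ≤ N → k ≢ c → g k ≈ 0#) → sumTo N g ≈ g c
  sumTo-single N (suc c) {g} _ c≤N others =
    begin
      sumTo N g               ≈⟨ sumTo-truncate (suc c) N c≤N above ⟩
      sumTo (suc c) g         ≈⟨ sumTo-suc c g ⟩
      sumTo c g + g (suc c)   ≈⟨ +-congʳ (sumTo-zero c below) ⟩
      0# + g (suc c)          ≈⟨ +-identityˡ _ ⟩
      g (suc c)               ∎
    where
    above : ∀ k → suc c ℕ.< k → k ≤ N → g k ≈ 0#
    above k c<k k≤N = others k (ℕₚ.≤-trans (s≤s z≤n) c<k) k≤N (λ k≡c → ℕₚ.<-irrefl (≡-sym k≡c) c<k)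
    below : ∀ k → 1 ≤ k → k ≤ c → g k ≈ 0#
    below k k≥1 k≤c = others k k≥1 (ℕₚ.≤-trans k≤c (ℕₚ.≤-trans (ℕₚ.n≤1+n c) c≤N)) (λ k≡c → ℕₚ.<-irrefl k≡c (s≤s k≤c))

  sumDiv : ℕ → (ℕ → Carrier) → Carrier
  sumDiv N g = sumOver (divisors N) g

  sumDiv-as-sumTo : ∀ N g → sumDiv N g ≈ sumTo N (λ k → 𝟙 (k ∣? N) * g k)
  sumDiv-as-sumTo N g = sumOver-filter (_∣? N) (range1 N) g

  sumDiv-cong : ∀ N {g h : ℕ → Carrier} → (∀ k → k ∣ N → g k ≈ h k) → sumDiv N g ≈ sumDiv N h
  sumDiv-cong N g≈h = sumOver-cong (divisors N) (λ k k∈ → g≈h k (proj₂ (∈-filter⁻ (_∣? N) {xs = range1 N} k∈)))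

  sumDiv-zero : ∀ N {g : ℕ → Carrier} → (∀ k → k ∣ N → g k ≈ 0#) → sumDiv N g ≈ 0#
  sumDiv-zero N g≈0 = sumOver-zero (divisors N) (λ k k∈ → g≈0 k (proj₂ (∈-filter⁻ (_∣? N) {xs = range1 N} k∈)))

  sumDiv-single : ∀ N c {g : ℕ → Carrier} → 1 ≤ N → c ∣ N → (∀ k → k ∣ N → k ≢ c → g k ≈ 0#) → sumDiv N g ≈ g c
  sumDiv-single N c {g} N≥1 c∣N others =
    begin
      sumDiv N g                          ≈⟨ sumDiv-as-sumTo N g ⟩
      sumTo N (λ k → 𝟙 (k ∣? N) * g k)    ≈⟨ sumTo-single N c (divisor-pos N≥1 c∣N) (divisor-≤ N≥1 c∣N) vanishes ⟩
      𝟙 (c ∣? N) * g c                    ≈⟨ 𝟙-yes-* (c ∣? N) c∣N ⟩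
      g c                                 ∎
    where
    vanishes : ∀ k → 1 ≤ k → k ≤ N → k ≢ c → 𝟙 (k ∣? N) * g k ≈ 0#
    vanishes k _ _ k≢c = trans (𝟙-guard (k ∣? N) (λ k∣N → others k k∣N k≢c)) (zeroʳ _)

module Determinants {c ℓ : Level} (R : CommutativeRing c ℓ) where
  open CommutativeRing R hiding (zero)
  open Arith R
  open FiniteSums R
  open import Algebra.Solver.Ring.NaturalCoefficients.Default commutativeSemiring
  open import Relation.Binary.Reasoning.Setoid setoid
  open import Algebra.Properties.Ring ring using (-0#≈0#; -‿involutive; -‿distribˡ-*; -‿distribʳ-*; +-inverseʳ-unique)

  Matrix : ℕ → Set c
  Matrix n = Fin n → Fin n → Carrier

  minor : ∀ {n} → Matrix (suc n) → Fin (suc n) → Matrix n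
  minor M j i k = M (fsuc i) (punchIn j k)

  cofactorTerm : ∀ {n} → Matrix (suc n) → Fin (suc n) → Carrier
  cofactorTerm M j = sgn (toℕ j) * (M fzero j * det (minor M j))

  det-expansion : ∀ {n} (M : Matrix (suc n)) → det M ≈ sumFin (cofactorTerm M)
  det-expansion M = sym (sumFin≈∑ (cofactorTerm M))

  det-cong : ∀ {n} {M N : Matrix n} → (∀ i j → M i j ≈ N i j) → det M ≈ det N
  det-cong {zero} _ = refl
  det-cong {suc n} {M} {N} M≈N =
    begin
      det M                     ≈⟨ det-expansion M ⟩
      sumFin (cofactorTerm M)   ≈⟨ sumFin-cong (λ j → *-congˡ (*-cong (M≈N fzero j) (det-cong (λ i k → M≈N (fsuc i) (punchIn j k))))) ⟩
      sumFin (cofactorTerm N)   ≈⟨ sym (det-expansion N) ⟩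
      det N                     ∎

  expansion-additive : ∀ {n} (M N P : Matrix (suc n)) → (∀ j → cofactorTerm P j ≈ cofactorTerm M j + cofactorTerm N j) →
                       det P ≈ det M + det N
  expansion-additive M N P termwise =
    begin
      det P                                           ≈⟨ det-expansion P ⟩
      sumFin (cofactorTerm P)                         ≈⟨ sumFin-cong termwise ⟩
      sumFin (λ j → cofactorTerm M j + cofactorTerm N j) ≈⟨ sumFin-+ (cofactorTerm M) (cofactorTerm N) ⟩
      sumFin (cofactorTerm M) + sumFin (cofactorTerm N) ≈⟨ +-cong (sym (det-expansion M)) (sym (det-expansion N)) ⟩
      det M + det N                                   ∎

  det-additive : ∀ {n} (M N P : Matrix n) (r : Fin n) →
                 (∀ i → i ≢ r → ∀ j → P i j ≈ M i j) → (∀ i → i ≢ r → ∀ j → P i j ≈ N i j) →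
                 (∀ j → P r j ≈ M r j + N r j) → det P ≈ det M + det N
  det-additive {suc n} M N P fzero P≈M P≈N P≈M+N = expansion-additive M N P termwise
    where
    sameMinor : ∀ j → det (minor P j) ≈ det (minor M j) × det (minor P j) ≈ det (minor N j)
    sameMinor j = det-cong (λ i k → P≈M (fsuc i) (λ ()) (punchIn j k)) , det-cong (λ i k → P≈N (fsuc i) (λ ()) (punchIn j k))
    termwise : ∀ j → cofactorTerm P j ≈ cofactorTerm M j + cofactorTerm N j
    termwise j =
      begin
        sgn (toℕ j) * (P fzero j * det (minor P j))
      ≈⟨ *-congˡ (trans (*-congʳ (P≈M+N j)) (distribʳ _ _ _)) ⟩
        sgn (toℕ j) * (M fzero j * det (minor P j) + N fzero j * det (minor P j))
      ≈⟨ distribˡ _ _ _ ⟩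
        sgn (toℕ j) * (M fzero j * det (minor P j)) + sgn (toℕ j) * (N fzero j * det (minor P j))
      ≈⟨ +-cong (*-congˡ (*-congˡ (proj₁ (sameMinor j)))) (*-congˡ (*-congˡ (proj₂ (sameMinor j)))) ⟩
        cofactorTerm M j + cofactorTerm N j
      ∎
  det-additive {suc n} M N P (fsuc r) P≈M P≈N P≈M+N = expansion-additive M N P termwise
    where
    minorAdditive : ∀ j → det (minor P j) ≈ det (minor M j) + det (minor N j)
    minorAdditive j = det-additive (minor M j) (minor N j) (minor P j) r
      (λ i i≢r k → P≈M (fsuc i) (λ e → i≢r (Finₚ.suc-injective e)) (punchIn j k))
      (λ i i≢r k → P≈N (fsuc i) (λ e → i≢r (Finₚ.suc-injective e)) (punchIn j k))
      (λ k → P≈M+N (punchIn j k))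
    termwise : ∀ j → cofactorTerm P j ≈ cofactorTerm M j + cofactorTerm N j
    termwise j =
      begin
        sgn (toℕ j) * (P fzero j * det (minor P j))
      ≈⟨ *-congˡ (*-congˡ (minorAdditive j)) ⟩
        sgn (toℕ j) * (P fzero j * (det (minor M j) + det (minor N j)))
      ≈⟨ trans (*-congˡ (distribˡ _ _ _)) (distribˡ _ _ _) ⟩
        sgn (toℕ j) * (P fzero j * det (minor M j)) + sgn (toℕ j) * (P fzero j * det (minor N j))
      ≈⟨ +-cong (*-congˡ (*-congʳ (P≈M fzero (λ ()) j))) (*-congˡ (*-congʳ (P≈N fzero (λ ()) j))) ⟩
        cofactorTerm M j + cofactorTerm N j
      ∎

  -- Functionals of a column embedding that respect pointwise equality of embeddings
  -- (needed because functions are not compared extensionally).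
  Extensional : ∀ {m p} → ((Fin m → Fin p) → Carrier) → Set ℓ
  Extensional {m} {p} Q = ∀ s s′ → (∀ l → s l ≡ s′ l) → Q s ≈ Q s′

  -- Extending a column embedding by column 0, to recurse into minors.
  lift : ∀ {m p} → (Fin m → Fin p) → Fin (suc m) → Fin (suc p)
  lift s fzero = fzero
  lift s (fsuc l) = fsuc (s l)

  lift-cong : ∀ {m p} (s s′ : Fin m → Fin p) → (∀ l → s l ≡ s′ l) → ∀ l → lift s l ≡ lift s′ l
  lift-cong s s′ s≗s′ fzero = ≡-refl
  lift-cong s s′ s≗s′ (fsuc l) = ≡-cong fsuc (s≗s′ l)

  -- Expansion of a determinant along two rows that both equal r: j is the column taken by
  -- the first row, k the column taken by the second among the remaining ones, and Q is
  -- evaluated at the embedding of the columns left over.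
  doubleExpansion : ∀ m → (Fin (suc (suc m)) → Carrier) → ((Fin m → Fin (suc (suc m))) → Carrier) → Carrier
  doubleExpansion m r Q =
    sumFin (λ j → sgn (toℕ j) * (r j * sumFin (λ k → sgn (toℕ k) * (r (punchIn j k) * Q (λ l → punchIn j (punchIn k l))))))

  -- The part of the double expansion where neither row uses column 0.
  innerExpansion : ∀ m → (Fin (suc (suc m)) → Carrier) → ((Fin m → Fin (suc (suc m))) → Carrier) → Carrier
  innerExpansion m r Q =
    sumFin (λ j → - sgn (toℕ j) * (r (fsuc j) * sumFin (λ k → - sgn (toℕ k) * (r (fsuc (punchIn j k)) * Q (λ l → punchIn (fsuc j) (punchIn (fsuc k) l))))))

  signs-cancel : ∀ s a y → (- s) * (a * (- y)) ≈ s * (a * y)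
  signs-cancel s a y =
    begin
      (- s) * (a * (- y))   ≈⟨ *-congˡ (sym (-‿distribʳ-* a y)) ⟩
      (- s) * (- (a * y))   ≈⟨ sym (-‿distribˡ-* s (- (a * y))) ⟩
      - (s * (- (a * y)))   ≈⟨ -‿cong (sym (-‿distribʳ-* s (a * y))) ⟩
      - (- (s * (a * y)))   ≈⟨ -‿involutive _ ⟩
      s * (a * y)           ∎

  doubleExpansion-vanishes : ∀ m r Q → Extensional Q → doubleExpansion m r Q ≈ 0#
  innerExpansion-vanishes : ∀ m r Q → Extensional Q → innerExpansion m r Q ≈ 0#

  -- Splitting off j = 0 and, for j > 0, k = 0: these cross terms cancel in pairs and
  -- what remains is the inner expansion.
  doubleExpansion-vanishes m r Q ext =
    begin
      doubleExpansion m r Q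
    ≈⟨ trans (sumFin-suc _) (+-congˡ (sumFin-cong (λ j → *-congˡ (*-congˡ (sumFin-suc _))))) ⟩
      1# * (r fzero * sumFin (λ k → s k * (a k * q k))) + sumFin (λ j → (- s j) * (a j * (1# * (r fzero * q j) + inner j)))
    ≈⟨ +-congˡ (trans (sumFin-cong (λ j → trans (*-congˡ (distribˡ _ _ _)) (distribˡ _ _ _))) (sumFin-+ _ _)) ⟩
      1# * (r fzero * sumFin (λ k → s k * (a k * q k))) + (sumFin (λ j → (- s j) * (a j * (1# * (r fzero * q j)))) + innerExpansion m r Q)
    ≈⟨ sym (+-assoc _ _ _) ⟩
      (1# * (r fzero * sumFin (λ k → s k * (a k * q k))) + sumFin (λ j → (- s j) * (a j * (1# * (r fzero * q j))))) + innerExpansion m r Q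
    ≈⟨ +-cong crossTerms-cancel (innerExpansion-vanishes m r Q ext) ⟩
      0# + 0#
    ≈⟨ +-identityˡ 0# ⟩
      0#
    ∎
    where
    s : ∀ {k} → Fin k → Carrier
    s k = sgn (toℕ k)
    a : Fin (suc m) → Carrier
    a k = r (fsuc k)
    q : Fin (suc m) → Carrier
    q k = Q (λ l → fsuc (punchIn k l))
    inner : Fin (suc m) → Carrier
    inner j = sumFin (λ k → s (fsuc k) * (r (fsuc (punchIn j k)) * Q (λ l → punchIn (fsuc j) (punchIn (fsuc k) l))))
    crossTerms-cancel : 1# * (r fzero * sumFin (λ k → s k * (a k * q k))) + sumFin (λ j → (- s j) * (a j * (1# * (r fzero * q j)))) ≈ 0#
    crossTerms-cancel =
      begin
        1# * (r fzero * sumFin (λ k → s k * (a k * q k))) + sumFin (λ j → (- s j) * (a j * (1# * (r fzero * q j))))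
      ≈⟨ +-congʳ (trans (*-identityˡ _) (sym (sumFin-*ˡ (r fzero) _))) ⟩
        sumFin (λ k → r fzero * (s k * (a k * q k))) + sumFin (λ j → (- s j) * (a j * (1# * (r fzero * q j))))
      ≈⟨ sym (sumFin-+ _ _) ⟩
        sumFin (λ k → r fzero * (s k * (a k * q k)) + (- s k) * (a k * (1# * (r fzero * q k))))
      ≈⟨ sumFin-zero (λ k → trans (+-congˡ (trans (sym (-‿distribˡ-* (s k) _)) (-‿cong (rearrange k)))) (-‿inverseʳ _)) ⟩
        0#
      ∎
      where
      rearrange : ∀ k → s k * (a k * (1# * (r fzero * q k))) ≈ r fzero * (s k * (a k * q k))
      rearrange k = solve 4 (λ s′ a′ r′ q′ → s′ :* (a′ :* (con 1 :* (r′ :* q′))) := r′ :* (s′ :* (a′ :* q′))) refl (s k) (a k) (r fzero) (q k)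

  innerExpansion-vanishes zero r Q ext = sumFin-zero (λ j → trans (*-congˡ (trans (*-congˡ (sumFin-empty _)) (zeroʳ _))) (zeroʳ _))
  innerExpansion-vanishes (suc m) r Q ext =
    begin
      innerExpansion (suc m) r Q
    ≈⟨ sumFin-cong (λ j → trans (*-congˡ (*-congˡ (trans (sumFin-cong (λ k → sym (-‿distribˡ-* _ _))) (sumFin-neg _)))) (signs-cancel _ _ _)) ⟩
      sumFin (λ j → sgn (toℕ j) * (r (fsuc j) * sumFin (λ k → sgn (toℕ k) * (r (fsuc (punchIn j k)) * Q (λ l → punchIn (fsuc j) (punchIn (fsuc k) l))))))
    ≈⟨ sumFin-cong (λ j → *-congˡ (*-congˡ (sumFin-cong (λ k → *-congˡ (*-congˡ (ext _ _ (liftedColumns j k))))))) ⟩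
      doubleExpansion m (λ j → r (fsuc j)) (λ t → Q (lift t))
    ≈⟨ doubleExpansion-vanishes m (λ j → r (fsuc j)) (λ t → Q (lift t)) (λ t t′ t≗t′ → ext _ _ (lift-cong t t′ t≗t′)) ⟩
      0#
    ∎
    where
    liftedColumns : ∀ j k l → punchIn (fsuc j) (punchIn (fsuc k) l) ≡ lift (λ l′ → punchIn j (punchIn k l′)) l
    liftedColumns j k fzero = ≡-refl
    liftedColumns j k (fsuc l) = ≡-refl

  det-firstRowsEqual : ∀ {m} (M : Matrix (suc (suc m))) → (∀ j → M fzero j ≈ M (fsuc fzero) j) → det M ≈ 0#
  det-firstRowsEqual {m} M rows≈ =
    begin
      det M
    ≈⟨ det-expansion M ⟩
      sumFin (cofactorTerm M)
    ≈⟨ sumFin-cong (λ j → *-congˡ (*-congˡ (trans (det-expansion (minor M j)) (sumFin-cong (λ k → *-congˡ (*-congʳ (sym (rows≈ (punchIn j k))))))))) ⟩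
      doubleExpansion m (M fzero) Q
    ≈⟨ doubleExpansion-vanishes m (M fzero) Q (λ t t′ t≗t′ → det-cong (λ i l → ≡⇒≈ (≡-cong (M (fsuc (fsuc i))) (t≗t′ l)))) ⟩
      0#
    ∎
    where
    Q : (Fin m → Fin (suc (suc m))) → Carrier
    Q t = det (λ i l → M (fsuc (fsuc i)) (t l))

  Alternating : ℕ → Set (c ⊔ ℓ)
  Alternating n = ∀ (M : Matrix n) a b → a ≢ b → (∀ j → M a j ≈ M b j) → det M ≈ 0#

  -- Two equal rows below the first give two equal rows in every minor.
  alternating-lowerRows : ∀ {n} → Alternating n → ∀ (M : Matrix (suc n)) a b → a ≢ b →
                          (∀ j → M (fsuc a) j ≈ M (fsuc b) j) → det M ≈ 0#
  alternating-lowerRows alt M a b a≢b rows≈ =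
    trans (det-expansion M)
          (sumFin-zero (λ j → trans (*-congˡ (trans (*-congˡ (alt (minor M j) a b a≢b (λ k → rows≈ (punchIn j k)))) (zeroʳ _))) (zeroʳ _)))

  -- M with rows a and b replaced by u and v (u wins if a = b).
  withRows : ∀ {n} → Matrix n → Fin n → Fin n → (Fin n → Carrier) → (Fin n → Carrier) → Matrix n
  withRows M a b u v i j with i ≟ a | i ≟ b
  ... | yes _ | _ = u j
  ... | no _ | yes _ = v j
  ... | no _ | no _ = M i j

  module _ {n} (M : Matrix n) (a b : Fin n) (a≢b : a ≢ b) where

    withRows-a : ∀ u v j → withRows M a b u v a j ≈ u j
    withRows-a u v j with a ≟ a
    ... | yes _ = refl
    ... | no a≢a = ⊥-elim (a≢a ≡-refl)

    withRows-b : ∀ u v j → withRows M a b u v b j ≈ v j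
    withRows-b u v j with b ≟ a | b ≟ b
    ... | yes b≡a | _ = ⊥-elim (a≢b (≡-sym b≡a))
    ... | no _ | yes _ = refl
    ... | no _ | no b≢b = ⊥-elim (b≢b ≡-refl)

    withRows-other : ∀ u v i → i ≢ a → i ≢ b → ∀ j → withRows M a b u v i j ≈ M i j
    withRows-other u v i i≢a i≢b j with i ≟ a | i ≟ b
    ... | yes i≡a | _ = ⊥-elim (i≢a i≡a)
    ... | no _ | yes i≡b = ⊥-elim (i≢b i≡b)
    ... | no _ | no _ = refl

    withRows-outside-a : ∀ u u′ v i → i ≢ a → ∀ j → withRows M a b u v i j ≈ withRows M a b u′ v i j
    withRows-outside-a u u′ v i i≢a j with i ≟ a | i ≟ b
    ... | yes i≡a | _ = ⊥-elim (i≢a i≡a)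
    ... | no _ | yes _ = refl
    ... | no _ | no _ = refl

    withRows-outside-b : ∀ u v v′ i → i ≢ b → ∀ j → withRows M a b u v i j ≈ withRows M a b u v′ i j
    withRows-outside-b u v v′ i i≢b j with i ≟ a | i ≟ b
    ... | yes _ | _ = refl
    ... | no _ | yes i≡b = ⊥-elim (i≢b i≡b)
    ... | no _ | no _ = refl

    withRows-additive-a : ∀ u u′ v → det (withRows M a b (λ j → u j + u′ j) v) ≈ det (withRows M a b u v) + det (withRows M a b u′ v)
    withRows-additive-a u u′ v = det-additive _ _ _ a (withRows-outside-a _ u v) (withRows-outside-a _ u′ v)
      (λ j → trans (withRows-a _ v j) (+-cong (sym (withRows-a u v j)) (sym (withRows-a u′ v j))))

    withRows-additive-b : ∀ u v v′ → det (withRows M a b u (λ j → v j + v′ j)) ≈ det (withRows M a b u v) + det (withRows M a b u v′)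
    withRows-additive-b u v v′ = det-additive _ _ _ b (withRows-outside-b u _ v) (withRows-outside-b u _ v′)
      (λ j → trans (withRows-b u _ j) (+-cong (sym (withRows-b u v j)) (sym (withRows-b u v′ j))))

    -- If the determinant vanishes whenever rows a and b agree, exchanging these two rows
    -- negates it: expand D(u+v, u+v) = 0 by additivity in both rows.
    swapRows-negates : (∀ (X : Matrix n) → (∀ j → X a j ≈ X b j) → det X ≈ 0#) →
                       det (withRows M a b (M b) (M a)) ≈ - det M
    swapRows-negates alt-ab = +-inverseʳ-unique (det M) (det (withRows M a b v u)) sum≈0
      where
      u v w : Fin n → Carrier
      u = M a
      v = M b
      w j = u j + v j
      D : (Fin n → Carrier) → (Fin n → Carrier) → Carrier
      D x y = det (withRows M a b x y)
      D-diagonal : ∀ x → D x x ≈ 0#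
      D-diagonal x = alt-ab _ (λ j → trans (withRows-a x x j) (sym (withRows-b x x j)))
      D-original : D u v ≈ det M
      D-original = det-cong rowwise
        where
        rowwise : ∀ i j → withRows M a b u v i j ≈ M i j
        rowwise i j with i ≟ a | i ≟ b
        ... | yes ≡-refl | _ = refl
        ... | no _ | yes ≡-refl = refl
        ... | no _ | no _ = refl
      sum≈0 : det M + D v u ≈ 0#
      sum≈0 =
        begin
          det M + D v u                       ≈⟨ +-cong (sym D-original) refl ⟩
          D u v + D v u                       ≈⟨ +-cong (sym (+-identityˡ _)) (sym (+-identityʳ _)) ⟩
          (0# + D u v) + (D v u + 0#)         ≈⟨ +-cong (+-congʳ (sym (D-diagonal u))) (+-congˡ (sym (D-diagonal v))) ⟩
          (D u u + D u v) + (D v u + D v v)   ≈⟨ +-cong (sym (withRows-additive-b u u v)) (sym (withRows-additive-b v u v)) ⟩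
          D u w + D v w                       ≈⟨ sym (withRows-additive-a u v w) ⟩
          D w w                               ≈⟨ D-diagonal w ⟩
          0#                                  ∎

  -- First row equal to row b+1: for b > 0 exchange rows 1 and b+1 first.
  alternating-firstRow : ∀ {n} → Alternating n → ∀ (M : Matrix (suc n)) b →
                         (∀ j → M fzero j ≈ M (fsuc b) j) → det M ≈ 0#
  alternating-firstRow {suc n} alt M fzero rows≈ = det-firstRowsEqual M rows≈
  alternating-firstRow {suc n} alt M (fsuc b) rows≈ =
    begin
      det M         ≈⟨ sym (-‿involutive _) ⟩
      - (- det M)   ≈⟨ -‿cong (sym exchanged) ⟩
      - det N       ≈⟨ -‿cong (det-firstRowsEqual N N₀≈N₁) ⟩
      - 0#          ≈⟨ -0#≈0# ⟩
      0#            ∎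
    where
    r₁ r₂ : Fin (suc (suc n))
    r₁ = fsuc fzero
    r₂ = fsuc (fsuc b)
    N : Matrix (suc (suc n))
    N = withRows M r₁ r₂ (M r₂) (M r₁)
    exchanged : det N ≈ - det M
    exchanged = swapRows-negates M r₁ r₂ (λ ()) (λ X → alternating-lowerRows alt X fzero (fsuc b) (λ ()))
    N₀≈N₁ : ∀ j → N fzero j ≈ N r₁ j
    N₀≈N₁ j = trans (withRows-other M r₁ r₂ (λ ()) (M r₂) (M r₁) fzero (λ ()) (λ ()) j)
                    (trans (rows≈ j) (sym (withRows-a M r₁ r₂ (λ ()) (M r₂) (M r₁) j)))

  det-alternating : ∀ n → Alternating n
  det-alternating zero M () b
  det-alternating (suc n) M fzero fzero a≢b _ = ⊥-elim (a≢b ≡-refl)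
  det-alternating (suc n) M fzero (fsuc b) _ rows≈ = alternating-firstRow (det-alternating n) M b rows≈
  det-alternating (suc n) M (fsuc a) fzero _ rows≈ = alternating-firstRow (det-alternating n) M a (λ j → sym (rows≈ j))
  det-alternating (suc n) M (fsuc a) (fsuc b) a≢b rows≈ =
    alternating-lowerRows (det-alternating n) M a b (λ a≡b → a≢b (≡-cong fsuc a≡b)) rows≈

  -- Replacing the first row: the cofactors along the first row do not depend on it.
  withFirstRow : ∀ {n} → Matrix (suc n) → (Fin (suc n) → Carrier) → Matrix (suc n)
  withFirstRow B u fzero = u
  withFirstRow B u (fsuc i) = B (fsuc i)

  -- Expanding det (E B) along the first row, the minors are of the same shape one size
  -- smaller, so by induction det (E B) = ∑_v E₀ᵥ det (B with first row Bᵥ); all terms with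
  -- v > 0 have two equal rows and E₀₀ = 1.
  det-unitriangular : ∀ {n} (E B : Matrix n) → (∀ i v → v < i → E i v ≈ 0#) → (∀ i → E i i ≈ 1#) →
                      det (λ i j → sumFin (λ v → E i v * B v j)) ≈ det B
  det-unitriangular {zero} _ _ _ _ = refl
  det-unitriangular {suc n} E B below diagonal =
    begin
      det EB
    ≈⟨ det-expansion EB ⟩
      sumFin (λ j → sgn (toℕ j) * (EB fzero j * det (minor EB j)))
    ≈⟨ sumFin-cong (λ j → trans (*-congˡ (*-congˡ (minor-reduces j))) (distribute j)) ⟩
      sumFin (λ j → sumFin (λ v → E fzero v * cofactorTerm (withFirstRow B (B v)) j))
    ≈⟨ sumFin-swap _ ⟩
      sumFin (λ v → sumFin (λ j → E fzero v * cofactorTerm (withFirstRow B (B v)) j))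
    ≈⟨ sumFin-cong (λ v → trans (sumFin-*ˡ (E fzero v) _) (*-congˡ (sym (det-expansion (withFirstRow B (B v)))))) ⟩
      sumFin (λ v → E fzero v * det (withFirstRow B (B v)))
    ≈⟨ sumFin-suc _ ⟩
      E fzero fzero * det (withFirstRow B (B fzero)) + sumFin (λ v → E fzero (fsuc v) * det (withFirstRow B (B (fsuc v))))
    ≈⟨ +-cong (trans (*-cong (diagonal fzero) (det-cong unchanged)) (*-identityˡ _))
              (sumFin-zero (λ v → trans (*-congˡ (alternating-firstRow (det-alternating n) (withFirstRow B (B (fsuc v))) v (λ _ → refl))) (zeroʳ _))) ⟩
      det B + 0#
    ≈⟨ +-identityʳ _ ⟩
      det B
    ∎
    where
    EB : Matrix (suc n)
    EB i j = sumFin (λ v → E i v * B v j)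
    minor-reduces : ∀ j → det (minor EB j) ≈ det (minor B j)
    minor-reduces j = trans (det-cong dropFirst)
      (det-unitriangular (λ i v → E (fsuc i) (fsuc v)) (minor B j) (λ i v v<i → below (fsuc i) (fsuc v) (s≤s v<i)) (λ i → diagonal (fsuc i)))
      where
      dropFirst : ∀ i k → minor EB j i k ≈ sumFin (λ v → E (fsuc i) (fsuc v) * minor B j v k)
      dropFirst i k = trans (sumFin-suc _) (trans (+-congʳ (trans (*-congʳ (below (fsuc i) fzero (s≤s z≤n))) (zeroˡ _))) (+-identityˡ _))
    distribute : ∀ j → sgn (toℕ j) * (EB fzero j * det (minor B j)) ≈ sumFin (λ v → E fzero v * cofactorTerm (withFirstRow B (B v)) j)
    distribute j =
      begin
        s * (EB fzero j * m)                                  ≈⟨ *-congˡ (trans (*-comm _ _) (sym (sumFin-*ˡ m _))) ⟩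
        s * sumFin (λ v → m * (E fzero v * B v j))            ≈⟨ sym (sumFin-*ˡ s _) ⟩
        sumFin (λ v → s * (m * (E fzero v * B v j)))          ≈⟨ sumFin-cong rearrange ⟩
        sumFin (λ v → E fzero v * (s * (B v j * m)))          ∎
      where
      s m : Carrier
      s = sgn (toℕ j)
      m = det (minor B j)
      rearrange : ∀ v → s * (m * (E fzero v * B v j)) ≈ E fzero v * (s * (B v j * m))
      rearrange v = solve 4 (λ s′ m′ e b → s′ :* (m′ :* (e :* b)) := e :* (s′ :* (b :* m′))) refl s m (E fzero v) (B v j)
    unchanged : ∀ i j → withFirstRow B (B fzero) i j ≈ B i j
    unchanged fzero j = refl
    unchanged (fsuc i) j = refl

  det-lowerTriangular : ∀ {n} (B : Matrix n) → (∀ i j → i < j → B i j ≈ 0#) → det B ≈ ∏ (λ i → B i i)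
  det-lowerTriangular {zero} _ _ = refl
  det-lowerTriangular {suc n} B above =
    begin
      det B
    ≈⟨ trans (det-expansion B) (sumFin-suc _) ⟩
      1# * (B fzero fzero * det (minor B fzero)) + sumFin (λ j → cofactorTerm B (fsuc j))
    ≈⟨ +-cong (*-identityˡ _) (sumFin-zero (λ j → trans (*-congˡ (trans (*-congʳ (above fzero (fsuc j) (s≤s z≤n))) (zeroˡ _))) (zeroʳ _))) ⟩
      B fzero fzero * det (minor B fzero) + 0#
    ≈⟨ trans (+-identityʳ _) (*-congˡ (det-lowerTriangular (minor B fzero) (λ i j i<j → above (fsuc i) (fsuc j) (s≤s i<j)))) ⟩
      ∏ (λ i → B i i)
    ∎

module DivisorSums {c ℓ : Level} (R : CommutativeRing c ℓ) where
  open CommutativeRing R hiding (zero)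
  open FiniteSums R
  open import Relation.Binary.Reasoning.Setoid setoid

  𝟙-absorb : ∀ {p q} {P : Set p} {Q : Set q} (d : Dec P) (e : Dec Q) {a} → (P → Q) → 𝟙 e * (𝟙 d * a) ≈ 𝟙 d * a
  𝟙-absorb (yes P) e P⇒Q = 𝟙-yes-* e (P⇒Q P)
  𝟙-absorb (no _) e {a} _ = trans (*-congˡ (zeroˡ a)) (trans (zeroʳ _) (sym (zeroˡ a)))

  sumDiv-restrict : ∀ y L (Ψ : ℕ → Carrier) → y ∣ L → 1 ≤ L → sumDiv L (λ z → 𝟙 (z ∣? y) * Ψ z) ≈ sumDiv y Ψ
  sumDiv-restrict y L Ψ y∣L L≥1 =
    begin
      sumDiv L (λ z → 𝟙 (z ∣? y) * Ψ z)                 ≈⟨ sumDiv-as-sumTo L _ ⟩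
      sumTo L (λ k → 𝟙 (k ∣? L) * (𝟙 (k ∣? y) * Ψ k))   ≈⟨ sumTo-cong L (λ k _ _ → 𝟙-absorb (k ∣? y) (k ∣? L) (λ k∣y → ∣-trans k∣y y∣L)) ⟩
      sumTo L (λ k → 𝟙 (k ∣? y) * Ψ k)                  ≈⟨ sumTo-truncate y L (divisor-≤ L≥1 y∣L) (λ k y<k _ → 𝟙-no-* (k ∣? y) (∤-larger y≥1 y<k)) ⟩
      sumTo y (λ k → 𝟙 (k ∣? y) * Ψ k)                  ≈⟨ sym (sumDiv-as-sumTo y Ψ) ⟩
      sumDiv y Ψ                                        ∎
    where y≥1 : 1 ≤ y
          y≥1 = divisor-pos L≥1 y∣L

  sumTo-multiples : ∀ w M (F : ℕ → Carrier) → 1 ≤ w → sumTo (M ℕ.* w) (λ k → 𝟙 (w ∣? k) * F k) ≈ sumTo M (λ j → F (j ℕ.* w))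
  sumTo-multiples w zero F _ = refl
  sumTo-multiples w (suc M) F w≥1 =
    begin
      sumTo (w ℕ.+ M ℕ.* w) (λ k → 𝟙 (w ∣? k) * F k)
    ≈⟨ sumTo-+ w (M ℕ.* w) _ ⟩
      sumTo w (λ k → 𝟙 (w ∣? k) * F k) + sumTo (M ℕ.* w) (λ k → 𝟙 (w ∣? (w ℕ.+ k)) * F (w ℕ.+ k))
    ≈⟨ +-cong firstBlock (sumTo-cong (M ℕ.* w) (λ k _ _ → *-congʳ (𝟙-⇔ (w ∣? (w ℕ.+ k)) (w ∣? k) (λ w∣w+k → ∣m+n∣m⇒∣n w∣w+k ∣-refl) (∣m∣n⇒∣m+n ∣-refl)))) ⟩
      F w + sumTo (M ℕ.* w) (λ k → 𝟙 (w ∣? k) * F (w ℕ.+ k))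
    ≈⟨ +-cong (≡⇒≈ (≡-cong F (≡-sym (ℕₚ.+-identityʳ w)))) (sumTo-multiples w M (λ k → F (w ℕ.+ k)) w≥1) ⟩
      F (1 ℕ.* w) + sumTo M (λ j → F (suc j ℕ.* w))
    ≈⟨ +-congʳ (trans (sym (+-identityˡ _)) (sym (sumTo-suc 0 (λ j → F (j ℕ.* w))))) ⟩
      sumTo 1 (λ j → F (j ℕ.* w)) + sumTo M (λ j → F (suc j ℕ.* w))
    ≈⟨ sym (sumTo-+ 1 M (λ j → F (j ℕ.* w))) ⟩
      sumTo (suc M) (λ j → F (j ℕ.* w))
    ∎
    where
    firstBlock : sumTo w (λ k → 𝟙 (w ∣? k) * F k) ≈ F w
    firstBlock = trans (sumTo-single w w w≥1 ℕₚ.≤-refl (λ k k≥1 k≤w k≢w → 𝟙-no-* (w ∣? k) (λ w∣k → k≢w (ℕₚ.≤-antisym k≤w (divisor-≤ k≥1 w∣k)))))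
                       (𝟙-yes-* (w ∣? w) ∣-refl)

  sumDiv-multiples : ∀ w y (φ : ℕ → Carrier) → w ∣ y → 1 ≤ y → sumDiv y (λ z → 𝟙 (w ∣? z) * φ z) ≈ sumDiv (y ÷ w) (λ e → φ (w ℕ.* e))
  sumDiv-multiples w y φ w∣y y≥1 =
    begin
      sumDiv y (λ z → 𝟙 (w ∣? z) * φ z)
    ≈⟨ sumDiv-as-sumTo y _ ⟩
      sumTo y (λ k → 𝟙 (k ∣? y) * (𝟙 (w ∣? k) * φ k))
    ≈⟨ sumTo-cong y (λ k _ _ → x∙yz≈y∙xz _ _ _) ⟩
      sumTo y (λ k → 𝟙 (w ∣? k) * (𝟙 (k ∣? y) * φ k))
    ≈⟨ ≡⇒≈ (≡-cong (λ t → sumTo t (λ k → 𝟙 (w ∣? k) * (𝟙 (k ∣? y) * φ k))) y≡Mw) ⟩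
      sumTo (M ℕ.* w) (λ k → 𝟙 (w ∣? k) * (𝟙 (k ∣? y) * φ k))
    ≈⟨ sumTo-multiples w M _ w≥1 ⟩
      sumTo M (λ j → 𝟙 ((j ℕ.* w) ∣? y) * φ (j ℕ.* w))
    ≈⟨ sumTo-cong M (λ j _ _ → *-cong (𝟙-⇔ ((j ℕ.* w) ∣? y) (j ∣? M) jw∣y⇒j∣M j∣M⇒jw∣y) (≡⇒≈ (≡-cong φ (ℕₚ.*-comm j w)))) ⟩
      sumTo M (λ j → 𝟙 (j ∣? M) * φ (w ℕ.* j))
    ≈⟨ sym (sumDiv-as-sumTo M _) ⟩
      sumDiv M (λ e → φ (w ℕ.* e))
    ∎
    where
    open import Algebra.Properties.CommutativeSemigroup *-commutativeSemigroup using (x∙yz≈y∙xz)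
    w≥1 : 1 ≤ w
    w≥1 = divisor-pos y≥1 w∣y
    M : ℕ
    M = y ÷ w
    y≡Mw : y ≡ M ℕ.* w
    y≡Mw = ≡-trans (≡-sym (÷-cancel w≥1 w∣y)) (ℕₚ.*-comm w M)
    instance w≢0 : NonZero w
    w≢0 = ≢-nonZero (λ w≡0 → ℕₚ.<-irrefl (≡-sym w≡0) w≥1)
    jw∣y⇒j∣M : ∀ {j} → j ℕ.* w ∣ y → j ∣ M
    jw∣y⇒j∣M jw∣y = *-cancelʳ-∣ w (≡-subst (_ ∣_) y≡Mw jw∣y)
    j∣M⇒jw∣y : ∀ {j} → j ∣ M → j ℕ.* w ∣ y
    j∣M⇒jw∣y j∣M = ≡-subst (_ ∣_) (≡-sym y≡Mw) (*-monoˡ-∣ w j∣M)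

  sumDiv-complement : ∀ N d (g : ℕ → Carrier) → 1 ≤ N → d ∣ N → sumDiv N (λ e → 𝟙 (d ℕ.* e ℕ.≟ N) * g e) ≈ g (N ÷ d)
  sumDiv-complement N d g N≥1 d∣N =
    trans (sumDiv-single N (N ÷ d) N≥1 (÷-divides d≥1 d∣N)
             (λ e _ e≢N/d → 𝟙-no-* (d ℕ.* e ℕ.≟ N) (λ de≡N → e≢N/d (≡-sym (÷-exact d≥1 de≡N)))))
          (𝟙-yes-* (d ℕ.* (N ÷ d) ℕ.≟ N) (÷-cancel d≥1 d∣N))
    where d≥1 : 1 ≤ d
          d≥1 = divisor-pos N≥1 d∣N

  sumDiv-reflect : ∀ N (φ : ℕ → Carrier) → 1 ≤ N → sumDiv N (λ d → φ (N ÷ d)) ≈ sumDiv N φ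
  sumDiv-reflect N φ N≥1 =
    begin
      sumDiv N (λ d → φ (N ÷ d))
    ≈⟨ sumDiv-cong N (λ d d∣N → sym (sumDiv-complement N d φ N≥1 d∣N)) ⟩
      sumDiv N (λ d → sumDiv N (λ e → 𝟙 (d ℕ.* e ℕ.≟ N) * φ e))
    ≈⟨ sumOver-swap (divisors N) (divisors N) _ ⟩
      sumDiv N (λ e → sumDiv N (λ d → 𝟙 (d ℕ.* e ℕ.≟ N) * φ e))
    ≈⟨ sumDiv-cong N (λ e e∣N → trans (sumOver-cong (divisors N) (λ d _ → *-congʳ (commuted d e))) (sumDiv-complement N e (λ _ → φ e) N≥1 e∣N)) ⟩
      sumDiv N φ
    ∎
    where
    commuted : ∀ d e → 𝟙 (d ℕ.* e ℕ.≟ N) ≈ 𝟙 (e ℕ.* d ℕ.≟ N)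
    commuted d e = 𝟙-⇔ (d ℕ.* e ℕ.≟ N) (e ℕ.* d ℕ.≟ N) (≡-trans (ℕₚ.*-comm e d)) (≡-trans (ℕₚ.*-comm d e))

  -- Σ_{z ∣ L} Σ_{a ∣ L/z} Φ(z, a) = Σ_{y ∣ L} Σ_{z ∣ y} Φ(z, y/z): both run over the pairs z ∣ y ∣ L.
  sumDiv-exchange : ∀ L (Φ : ℕ → ℕ → Carrier) → 1 ≤ L →
                    sumDiv L (λ z → sumDiv (L ÷ z) (Φ z)) ≈ sumDiv L (λ y → sumDiv y (λ z → Φ z (y ÷ z)))
  sumDiv-exchange L Φ L≥1 = sym (
    begin
      sumDiv L (λ y → sumDiv y (λ z → Φ z (y ÷ z)))
    ≈⟨ sumDiv-cong L (λ y y∣L → sym (sumDiv-restrict y L (λ z → Φ z (y ÷ z)) y∣L L≥1)) ⟩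
      sumDiv L (λ y → sumDiv L (λ z → 𝟙 (z ∣? y) * Φ z (y ÷ z)))
    ≈⟨ sumOver-swap (divisors L) (divisors L) _ ⟩
      sumDiv L (λ z → sumDiv L (λ y → 𝟙 (z ∣? y) * Φ z (y ÷ z)))
    ≈⟨ sumDiv-cong L (λ z z∣L → sumDiv-multiples z L (λ y → Φ z (y ÷ z)) z∣L L≥1) ⟩
      sumDiv L (λ z → sumDiv (L ÷ z) (λ a → Φ z ((z ℕ.* a) ÷ z)))
    ≈⟨ sumDiv-cong L (λ z z∣L → sumOver-cong (divisors (L ÷ z)) (λ a _ → ≡⇒≈ (≡-cong (Φ z) (÷-exact (divisor-pos L≥1 z∣L) ≡-refl)))) ⟩
      sumDiv L (λ z → sumDiv (L ÷ z) (Φ z))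
    ∎)

-- ω (p d) = ω d + 1 for a prime p ∤ d, by counting prime divisors as a sum of brackets in ℤ.
module PrimeDivisorCount where
  open FiniteSums ℤₚ.+-*-commutativeRing
  open import Relation.Binary.PropositionalEquality using (module ≡-Reasoning) renaming (cong₂ to ≡-cong₂)

  length-filter : ∀ {p} {P : ℕ → Set p} (P? : ∀ k → Dec (P k)) l → + length (filter P? l) ≡ sumOver l (λ k → 𝟙 (P? k))
  length-filter P? [] = ≡-refl
  length-filter P? (k ∷ l) with P? k
  ... | yes _ = ≡-cong (λ t → + 1 ℤ.+ t) (length-filter P? l)
  ... | no _ = ≡-trans (length-filter P? l) (≡-sym (ℤₚ.+-identityˡ _))

  ω-as-sum : ∀ n → + ω n ≡ sumTo n (λ k → 𝟙 (k ∣? n) ℤ.* 𝟙 (prime? k))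
  ω-as-sum n = ≡-trans (length-filter prime? (divisors n)) (sumOver-filter (_∣? n) (range1 n) (λ k → 𝟙 (prime? k)))

  ω-prime-multiple : ∀ {p d} → Prime p → ¬ (p ∣ d) → 1 ≤ d → ω (p ℕ.* d) ≡ suc (ω d)
  ω-prime-multiple {p} {d} pp p∤d d≥1 = ℤₚ.+-injective (begin
      + ω (p ℕ.* d)
    ≡⟨ ω-as-sum (p ℕ.* d) ⟩
      sumTo (p ℕ.* d) (λ k → 𝟙 (k ∣? p ℕ.* d) ℤ.* 𝟙 (prime? k))
    ≡⟨ sumTo-cong (p ℕ.* d) (λ k _ _ → splitPrimeDivisor k) ⟩
      sumTo (p ℕ.* d) (λ k → 𝟙 (k ∣? d) ℤ.* 𝟙 (prime? k) ℤ.+ 𝟙 (k ℕ.≟ p))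
    ≡⟨ sumOver-+ (range1 (p ℕ.* d)) _ _ ⟩
      sumTo (p ℕ.* d) (λ k → 𝟙 (k ∣? d) ℤ.* 𝟙 (prime? k)) ℤ.+ sumTo (p ℕ.* d) (λ k → 𝟙 (k ℕ.≟ p))
    ≡⟨ ≡-cong₂ ℤ._+_ (sumTo-truncate d (p ℕ.* d) (ℕₚ.m≤n*m d p) (λ k d<k _ → 𝟙-no-* (k ∣? d) (∤-larger d≥1 d<k)))
                   (sumTo-single (p ℕ.* d) p p≥1 (ℕₚ.m≤m*n p d) (λ k _ _ k≢p → 𝟙-no (k ℕ.≟ p) k≢p)) ⟩
      sumTo d (λ k → 𝟙 (k ∣? d) ℤ.* 𝟙 (prime? k)) ℤ.+ 𝟙 (p ℕ.≟ p)
    ≡⟨ ≡-cong₂ ℤ._+_ (≡-sym (ω-as-sum d)) (𝟙-yes (p ℕ.≟ p) ≡-refl) ⟩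
      + ω d ℤ.+ + 1
    ≡⟨ ℤₚ.+-comm (+ ω d) (+ 1) ⟩
      + suc (ω d)
    ∎)
    where
    open ≡-Reasoning
    p≥1 : 1 ≤ p
    p≥1 = ℕₚ.≤-trans (s≤s z≤n) (prime≥2 pp)
    instance
      d≢0 : NonZero d
      d≢0 = ≢-nonZero (λ d≡0 → ℕₚ.<-irrefl (≡-sym d≡0) d≥1)
      p≢0 : NonZero p
      p≢0 = ≢-nonZero (λ p≡0 → ℕₚ.<-irrefl (≡-sym p≡0) p≥1)
    splitPrimeDivisor : ∀ k → 𝟙 (k ∣? p ℕ.* d) ℤ.* 𝟙 (prime? k) ≡ 𝟙 (k ∣? d) ℤ.* 𝟙 (prime? k) ℤ.+ 𝟙 (k ℕ.≟ p)
    splitPrimeDivisor k with prime? k | k ∣? d | k ℕ.≟ p | k ∣? p ℕ.* d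
    ... | no ¬pk | _ | yes ≡-refl | _ = ⊥-elim (¬pk pp)
    ... | no _ | yes _ | no _ | yes _ = ≡-refl
    ... | no _ | yes _ | no _ | no _ = ≡-refl
    ... | no _ | no _ | no _ | yes _ = ≡-refl
    ... | no _ | no _ | no _ | no _ = ≡-refl
    ... | yes _ | yes k∣d | yes ≡-refl | _ = ⊥-elim (p∤d k∣d)
    ... | yes _ | yes _ | no _ | yes _ = ≡-refl
    ... | yes _ | yes k∣d | no _ | no k∤pd = ⊥-elim (k∤pd (∣n⇒∣m*n p k∣d))
    ... | yes _ | no _ | yes ≡-refl | yes _ = ≡-refl
    ... | yes _ | no _ | yes ≡-refl | no k∤pd = ⊥-elim (k∤pd (m∣m*n d))
    ... | yes pk | no k∤d | no k≢p | yes k∣pd with euclidsLemma p d pk k∣pd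
    ...   | inj₁ k∣p = ⊥-elim (k≢p (prime∣prime pk pp k∣p))
    ...   | inj₂ k∣d = ⊥-elim (k∤d k∣d)
    splitPrimeDivisor k | yes _ | no _ | no _ | no _ = ≡-refl

squareFactor-∈ : ∀ {e n} → 1 ≤ n → 2 ≤ e → e ℕ.* e ∣ n → e ∈ squarefreeList n
squareFactor-∈ {e} {n} n≥1 e≥2 ee∣n =
  ∈-filter⁺ (λ d → d ℕ.* d ∣? n) (∈-filter⁺ (λ d → 2 ℕ.≤? d) (range1-∈⁺ (ℕₚ.≤-trans (s≤s z≤n) e≥2) e≤n) e≥2) ee∣n
  where e≤n : e ≤ n
        e≤n = divisor-≤ n≥1 (m*n∣⇒m∣ e e ee∣n)

∈-squareFactor : ∀ {e n} → e ∈ squarefreeList n → 2 ≤ e × e ℕ.* e ∣ n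
∈-squareFactor {e} {n} e∈ with ∈-filter⁻ (λ d → d ℕ.* d ∣? n) e∈
... | e∈′ , ee∣n = proj₂ (∈-filter⁻ (λ d → 2 ℕ.≤? d) {xs = range1 n} e∈′) , ee∣n

HasSquareFactor : ℕ → Set
HasSquareFactor n = ∃ λ e → 2 ≤ e × e ℕ.* e ∣ n

hasSquareFactor? : ∀ {n} → 1 ≤ n → HasSquareFactor n ⊎ ¬ HasSquareFactor n
hasSquareFactor? {n} n≥1 with squarefreeList n in eq
... | e ∷ _ = inj₁ (e , ∈-squareFactor (≡-subst (e ∈_) (≡-sym eq) (here ≡-refl)))
... | [] = inj₂ λ { (e , e≥2 , ee∣n) → ¬Any[] (≡-subst (e ∈_) eq (squareFactor-∈ n≥1 e≥2 ee∣n)) }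

-- A square factor of p d, for a prime p ∤ d, yields one of d (through a prime factor of it).
squareFactor-cancelPrime : ∀ {p d} → Prime p → ¬ p ∣ d → HasSquareFactor (p ℕ.* d) → HasSquareFactor d
squareFactor-cancelPrime {p} {d} pp p∤d (e , e≥2 , ee∣pd) with primeFactor e e≥2
... | q , qq , q∣e with q ℕ.≟ p
...   | yes ≡-refl = ⊥-elim (p∤d (*-cancelˡ-∣ p (∣-trans (*-pres-∣ q∣e q∣e) ee∣pd)))
  where instance p≢0 : NonZero p
                 p≢0 = ≢-nonZero (λ p≡0 → ℕₚ.<-irrefl (≡-sym p≡0) (ℕₚ.≤-trans (s≤s z≤n) (prime≥2 pp)))
...   | no q≢p = q , prime≥2 qq , coprime-divisor (coprime-square qq pp q≢p) (∣-trans (*-pres-∣ q∣e q∣e) ee∣pd)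

module Mobius {c ℓ : Level} (R : CommutativeRing c ℓ) where
  open CommutativeRing R hiding (zero)
  open Arith R
  open FiniteSums R
  open DivisorSums R
  open import Relation.Binary.Reasoning.Setoid setoid
  open import Algebra.Properties.Ring ring using (-0#≈0#)

  μ-square : ∀ {n} → 1 ≤ n → HasSquareFactor n → μ n ≈ 0#
  μ-square {suc n} n≥1 (e , e≥2 , ee∣n) with squarefreeList (suc n) in eq
  ... | _ ∷ _ = refl
  ... | [] = ⊥-elim (¬Any[] (≡-subst (e ∈_) eq (squareFactor-∈ n≥1 e≥2 ee∣n)))

  μ-squarefree : ∀ {n} → 1 ≤ n → ¬ HasSquareFactor n → μ n ≈ sgn (ω n)
  μ-squarefree {suc n} _ noSquare with squarefreeList (suc n) in eq
  ... | [] = refl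
  ... | e ∷ _ = ⊥-elim (noSquare (e , ∈-squareFactor (≡-subst (e ∈_) (≡-sym eq) (here ≡-refl))))

  μ-prime-multiple : ∀ {p d} → Prime p → ¬ p ∣ d → 1 ≤ d → μ (p ℕ.* d) ≈ - μ d
  μ-prime-multiple {p} {d} pp p∤d d≥1 = byCases (hasSquareFactor? d≥1)
    where
    pd≥1 : 1 ≤ p ℕ.* d
    pd≥1 = ℕₚ.*-mono-≤ (ℕₚ.≤-trans (s≤s z≤n) (prime≥2 pp)) d≥1
    byCases : HasSquareFactor d ⊎ ¬ HasSquareFactor d → μ (p ℕ.* d) ≈ - μ d
    byCases (inj₁ (e , e≥2 , ee∣d)) =
      trans (μ-square pd≥1 (e , e≥2 , ∣n⇒∣m*n p ee∣d)) (sym (trans (-‿cong (μ-square d≥1 (e , e≥2 , ee∣d))) -0#≈0#))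
    byCases (inj₂ noSquare) =
      begin
        μ (p ℕ.* d)          ≈⟨ μ-squarefree pd≥1 (λ sq → noSquare (squareFactor-cancelPrime pp p∤d sq)) ⟩
        sgn (ω (p ℕ.* d))    ≡⟨ ≡-cong sgn (PrimeDivisorCount.ω-prime-multiple pp p∤d d≥1) ⟩
        - sgn (ω d)          ≈⟨ -‿cong (sym (μ-squarefree d≥1 noSquare)) ⟩
        - μ d                ∎

  -- Σ_{d ∣ m} μ(d) = [m = 1].  For m > 1 pick a prime p ∣ m: the divisors p e contribute
  -- -μ(e) for e ∣ m/p with p ∤ e, cancelling the divisors d with p ∤ d, which divide m/p.
  sumDiv-μ : ∀ m → 1 ≤ m → sumDiv m μ ≈ 𝟙 (m ℕ.≟ 1)
  sumDiv-μ (suc zero) _ = +-identityʳ 1#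
  sumDiv-μ m@(suc (suc _)) m≥1 with primeFactor m (s≤s (s≤s z≤n))
  ... | p , pp , p∣m =
    begin
      sumDiv m μ
    ≈⟨ sumDiv-cong m (λ d _ → trans (sym (*-identityˡ (μ d))) (trans (*-congʳ (sym (𝟙-complement (p ∣? d)))) (distribʳ _ _ _))) ⟩
      sumDiv m (λ d → 𝟙 (p ∣? d) * μ d + 𝟙 (¬? (p ∣? d)) * μ d)
    ≈⟨ sumOver-+ (divisors m) _ _ ⟩
      sumDiv m (λ d → 𝟙 (p ∣? d) * μ d) + sumDiv m (λ d → 𝟙 (¬? (p ∣? d)) * μ d)
    ≈⟨ +-cong (sumDiv-multiples p m μ p∣m m≥1) coprimePart ⟩
      sumDiv m′ (λ e → μ (p ℕ.* e)) + sumDiv m′ (λ e → 𝟙 (¬? (p ∣? e)) * μ e)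
    ≈⟨ trans (+-congʳ (sumDiv-cong m′ (λ e e∣m′ → multiplePart e (divisor-pos m′≥1 e∣m′)))) (sym (sumOver-+ (divisors m′) _ _)) ⟩
      sumDiv m′ (λ e → 𝟙 (¬? (p ∣? e)) * (- μ e) + 𝟙 (¬? (p ∣? e)) * μ e)
    ≈⟨ sumDiv-zero m′ (λ e _ → trans (sym (distribˡ _ _ _)) (trans (*-congˡ (-‿inverseˡ (μ e))) (zeroʳ _))) ⟩
      0#
    ∎
    where
    p≥1 : 1 ≤ p
    p≥1 = ℕₚ.≤-trans (s≤s z≤n) (prime≥2 pp)
    m′ : ℕ
    m′ = m ÷ p
    m′≥1 : 1 ≤ m′
    m′≥1 = ÷-pos p≥1 p∣m m≥1
    multiplePart : ∀ e → 1 ≤ e → μ (p ℕ.* e) ≈ 𝟙 (¬? (p ∣? e)) * (- μ e)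
    multiplePart e e≥1 with p ∣? e
    ... | yes p∣e = trans (μ-square (ℕₚ.*-mono-≤ p≥1 e≥1) (p , prime≥2 pp , *-monoʳ-∣ p p∣e)) (sym (zeroˡ _))
    ... | no p∤e = trans (μ-prime-multiple pp p∤e e≥1) (sym (*-identityˡ _))
    -- A divisor of m not divisible by p divides m / p.
    coprimePart : sumDiv m (λ d → 𝟙 (¬? (p ∣? d)) * μ d) ≈ sumDiv m′ (λ d → 𝟙 (¬? (p ∣? d)) * μ d)
    coprimePart = trans (sumDiv-cong m (λ d d∣m → sym (𝟙-absorb (¬? (p ∣? d)) (d ∣? m′)
                           (λ p∤d → coprime-divisor (coprime-prime pp p∤d) (≡-subst (d ∣_) (≡-sym (÷-cancel p≥1 p∣m)) d∣m)))))
                        (sumDiv-restrict m′ m _ (÷-divides p≥1 p∣m) m≥1)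

  sumDiv-μ-between : ∀ w y → 1 ≤ y → sumDiv y (λ z → 𝟙 (w ∣? z) * μ (y ÷ z)) ≈ 𝟙 (y ℕ.≟ w)
  sumDiv-μ-between w y y≥1 with w ∣? y
  ... | no w∤y = trans (sumDiv-zero y (λ z z∣y → 𝟙-no-* (w ∣? z) (λ w∣z → w∤y (∣-trans w∣z z∣y))))
                       (sym (𝟙-no (y ℕ.≟ w) (λ { ≡-refl → w∤y ∣-refl })))
  ... | yes w∣y =
    begin
      sumDiv y (λ z → 𝟙 (w ∣? z) * μ (y ÷ z))   ≈⟨ sumDiv-multiples w y (λ z → μ (y ÷ z)) w∣y y≥1 ⟩
      sumDiv Y (λ e → μ (y ÷ (w ℕ.* e)))        ≈⟨ sumDiv-cong Y (λ e e∣Y → ≡⇒≈ (≡-cong μ (quotient-of-product e e∣Y))) ⟩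
      sumDiv Y (λ e → μ (Y ÷ e))                ≈⟨ sumDiv-reflect Y μ Y≥1 ⟩
      sumDiv Y μ                                ≈⟨ sumDiv-μ Y Y≥1 ⟩
      𝟙 (Y ℕ.≟ 1)                               ≈⟨ 𝟙-⇔ (Y ℕ.≟ 1) (y ℕ.≟ w) Y≡1⇒y≡w y≡w⇒Y≡1 ⟩
      𝟙 (y ℕ.≟ w)                               ∎
    where
    w≥1 : 1 ≤ w
    w≥1 = divisor-pos y≥1 w∣y
    Y : ℕ
    Y = y ÷ w
    Y≥1 : 1 ≤ Y
    Y≥1 = ÷-pos w≥1 w∣y y≥1
    quotient-of-product : ∀ e → e ∣ Y → y ÷ (w ℕ.* e) ≡ Y ÷ e
    quotient-of-product e e∣Y = ÷-exact (ℕₚ.*-mono-≤ w≥1 (divisor-pos Y≥1 e∣Y))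
      (≡-trans (ℕₚ.*-assoc w e (Y ÷ e)) (≡-trans (≡-cong (w ℕ.*_) (÷-cancel (divisor-pos Y≥1 e∣Y) e∣Y)) (÷-cancel w≥1 w∣y)))
    Y≡1⇒y≡w : Y ≡ 1 → y ≡ w
    Y≡1⇒y≡w Y≡1 = ≡-trans (≡-sym (÷-cancel w≥1 w∣y)) (≡-trans (≡-cong (w ℕ.*_) Y≡1) (ℕₚ.*-identityʳ w))
    y≡w⇒Y≡1 : y ≡ w → Y ≡ 1
    y≡w⇒Y≡1 y≡w = ÷-exact w≥1 (≡-trans (ℕₚ.*-identityʳ w) (≡-sym y≡w))

  -- The function whose sums over multiples recover f on the divisors of L:
  -- g(z) = (ζ ⋆ (f_z μ))(L / z).
  inversionKernel : (ℕ → Carrier) → ℕ → ℕ → Carrier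
  inversionKernel f L z = (ζ ⋆ (shift f z · μ)) (L ÷ z)

  inversionKernel-sum : ∀ f L z → 1 ≤ L → z ∣ L → inversionKernel f L z ≈ sumDiv (L ÷ z) (λ a → f (z ℕ.* a) * μ a)
  inversionKernel-sum f L z L≥1 z∣L =
    trans (sumOver-cong (divisors (L ÷ z)) (λ _ _ → *-identityˡ _))
          (sumDiv-reflect (L ÷ z) (λ a → f (z ℕ.* a) * μ a) (÷-pos (divisor-pos L≥1 z∣L) z∣L L≥1))

  mobiusInversion : ∀ f L w → 1 ≤ L → w ∣ L → sumDiv L (λ z → 𝟙 (w ∣? z) * inversionKernel f L z) ≈ f w
  mobiusInversion f L w L≥1 w∣L =
    begin
      sumDiv L (λ z → 𝟙 (w ∣? z) * inversionKernel f L z)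
    ≈⟨ sumDiv-cong L (λ z z∣L → trans (*-congˡ (inversionKernel-sum f L z L≥1 z∣L)) (sym (sumOver-*ˡ (divisors (L ÷ z)) _ _))) ⟩
      sumDiv L (λ z → sumDiv (L ÷ z) (λ a → 𝟙 (w ∣? z) * (f (z ℕ.* a) * μ a)))
    ≈⟨ sumDiv-exchange L (λ z a → 𝟙 (w ∣? z) * (f (z ℕ.* a) * μ a)) L≥1 ⟩
      sumDiv L (λ y → sumDiv y (λ z → 𝟙 (w ∣? z) * (f (z ℕ.* (y ÷ z)) * μ (y ÷ z))))
    ≈⟨ sumDiv-cong L (λ y y∣L → onLevel y (divisor-pos L≥1 y∣L)) ⟩
      sumDiv L (λ y → 𝟙 (y ℕ.≟ w) * f y)
    ≈⟨ sumDiv-single L w L≥1 w∣L (λ y _ y≢w → 𝟙-no-* (y ℕ.≟ w) y≢w) ⟩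
      𝟙 (w ℕ.≟ w) * f w
    ≈⟨ 𝟙-yes-* (w ℕ.≟ w) ≡-refl ⟩
      f w
    ∎
    where
    onLevel : ∀ y → 1 ≤ y → sumDiv y (λ z → 𝟙 (w ∣? z) * (f (z ℕ.* (y ÷ z)) * μ (y ÷ z))) ≈ 𝟙 (y ℕ.≟ w) * f y
    onLevel y y≥1 =
      begin
        sumDiv y (λ z → 𝟙 (w ∣? z) * (f (z ℕ.* (y ÷ z)) * μ (y ÷ z)))
      ≈⟨ sumDiv-cong y (λ z z∣y → trans (*-congˡ (*-congʳ (≡⇒≈ (≡-cong f (÷-cancel (divisor-pos y≥1 z∣y) z∣y))))) (x∙yz≈y∙xz _ _ _)) ⟩
        sumDiv y (λ z → f y * (𝟙 (w ∣? z) * μ (y ÷ z)))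
      ≈⟨ sumOver-*ˡ (divisors y) (f y) _ ⟩
        f y * sumDiv y (λ z → 𝟙 (w ∣? z) * μ (y ÷ z))
      ≈⟨ trans (*-congˡ (sumDiv-μ-between w y y≥1)) (*-comm _ _) ⟩
        𝟙 (y ℕ.≟ w) * f y
      ∎
      where open import Algebra.Properties.CommutativeSemigroup *-commutativeSemigroup using (x∙yz≈y∙xz)

module LCMMatrix {c ℓ : Level} (R : CommutativeRing c ℓ) {n : ℕ} (x : Fin n → ℕ)
                 (positive : ∀ i → 1 ≤ x i) (closed : LCMClosed x) (ordered : ∀ i j → x i ∣ x j → i Data.Fin.≤ j)
                 (f : ℕ → CommutativeRing.Carrier R) where
  open CommutativeRing R hiding (zero)
  open Arith R
  open FiniteSums R
  open Mobius R
  open Determinants R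
  open import Relation.Binary.Reasoning.Setoid setoid

  IsTop : Fin n → ℕ → Set
  IsTop v k = x v ∣ k × (∀ (t : Fin n) → v < t → ¬ x t ∣ k)

  noLater? : ∀ (v : Fin n) k → Dec (∀ (t : Fin n) → v < t → ¬ x t ∣ k)
  noLater? v k = Finₚ.all? (λ t → (v <? t) →-dec ¬? (x t ∣? k))

  isTop? : ∀ (v : Fin n) k → Dec (IsTop v k)
  isTop? v k = (x v ∣? k) ×-dec noLater? v k

  top-unique : ∀ {v t k} → IsTop v k → IsTop t k → t ≡ v
  top-unique (xv∣k , noneAfterV) (xt∣k , noneAfterT) =
    Finₚ.≤-antisym (ℕₚ.≮⇒≥ (λ v<t → noneAfterV _ v<t xt∣k)) (ℕₚ.≮⇒≥ (λ t<v → noneAfterT _ t<v xv∣k))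

  -- Every x_a dividing k divides the top element: [x_a, x_v] ∈ S divides k and lies
  -- at an index ≥ v (by the ordering), hence at v itself.
  top-absorbs : ∀ {a v k} → IsTop v k → x a ∣ k → x a ∣ x v
  top-absorbs {a} {v} {k} (xv∣k , noneAfter) xa∣k with closed a v
  ... | m , xm≡lcm = ≡-subst (λ t → x a ∣ x t) m≡v (≡-subst (x a ∣_) (≡-sym xm≡lcm) (m∣lcm[m,n] (x a) (x v)))
    where
    m≡v : m ≡ v
    m≡v = Finₚ.≤-antisym (ℕₚ.≮⇒≥ (λ v<m → noneAfter m v<m (≡-subst (_∣ k) (≡-sym xm≡lcm) (lcm-least xa∣k xv∣k))))
                         (ordered v m (≡-subst (x v ∣_) (≡-sym xm≡lcm) (n∣lcm[m,n] (x a) (x v))))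

  L : ℕ
  L = lcmAll x

  L≥1 : 1 ≤ L
  L≥1 = lcmAll-pos x positive

  g : ℕ → Carrier
  g = inversionKernel f L

  E : Matrix n
  E i v = 𝟙 (x i ∣? x v)

  E-below : ∀ i v → v < i → E i v ≈ 0#
  E-below i v v<i = 𝟙-no (x i ∣? x v) (λ xi∣xv → ℕₚ.<⇒≱ v<i (ordered i v xi∣xv))

  E-diagonal : ∀ i → E i i ≈ 1#
  E-diagonal i = 𝟙-yes (x i ∣? x i) ∣-refl

  h : Fin n → Carrier
  h v = sumOver (zsFor x v) g

  h-as-sum : ∀ v → h v ≈ sumDiv L (λ k → 𝟙 (isTop? v k) * g k)
  h-as-sum v =
    begin
      sumOver (filter (x v ∣?_) (filter (noLater? v) (divisors L))) g
    ≈⟨ sumOver-filter (x v ∣?_) (filter (noLater? v) (divisors L)) g ⟩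
      sumOver (filter (noLater? v) (divisors L)) (λ k → 𝟙 (x v ∣? k) * g k)
    ≈⟨ sumOver-filter (noLater? v) (divisors L) _ ⟩
      sumDiv L (λ k → 𝟙 (noLater? v k) * (𝟙 (x v ∣? k) * g k))
    ≈⟨ sumOver-cong (divisors L) (λ k _ → trans (sym (*-assoc _ _ _)) (*-congʳ (trans (*-comm _ _) (sym (𝟙-× (x v ∣? k) (noLater? v k)))))) ⟩
      sumDiv L (λ k → 𝟙 (isTop? v k) * g k)
    ∎

  Chain : Fin n → Fin n → Fin n → ℕ → Set
  Chain i j v k = x i ∣ x v × x j ∣ x v × IsTop v k

  chain? : ∀ i j v k → Dec (Chain i j v k)
  chain? i j v k = (x i ∣? x v) ×-dec (x j ∣? x v) ×-dec isTop? v k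

  countChains : ∀ i j k → sumFin (λ v → 𝟙 (chain? i j v k)) ≈ 𝟙 (lcm (x i) (x j) ∣? k)
  countChains i j k with lcm (x i) (x j) ∣? k
  ... | no w∤k = sumFin-zero (λ v → 𝟙-no (chain? i j v k)
                   λ { (xi∣xv , xj∣xv , xv∣k , _) → w∤k (lcm-least (∣-trans xi∣xv xv∣k) (∣-trans xj∣xv xv∣k)) })
  ... | yes w∣k with largestWitness (λ t → x t ∣? k) i (∣-trans (m∣lcm[m,n] (x i) (x j)) w∣k)
  ...   | v , xv∣k , noneAfter =
    trans (sumFin-single _ v (λ t t≢v → 𝟙-no (chain? i j t k) (λ chain → t≢v (top-unique top (proj₂ (proj₂ chain))))))
          (𝟙-yes (chain? i j v k) (top-absorbs top (∣-trans (m∣lcm[m,n] (x i) (x j)) w∣k) ,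
                                  top-absorbs top (∣-trans (n∣lcm[m,n] (x i) (x j)) w∣k) , top))
    where top : IsTop v k
          top = xv∣k , noneAfter

  -- [S]_f = E · diag(h) · Eᵀ: both sides equal Σ_{[x_i,x_j] ∣ k ∣ L} g(k).
  factorisation : ∀ i j → f (lcm (x i) (x j)) ≈ sumFin (λ v → E i v * (h v * E j v))
  factorisation i j = sym (
    begin
      sumFin (λ v → E i v * (h v * E j v))
    ≈⟨ sumFin-cong termAsSum ⟩
      sumFin (λ v → sumDiv L (λ k → 𝟙 (chain? i j v k) * g k))
    ≈⟨ sym (sumOver-sumFin (divisors L) (λ v k → 𝟙 (chain? i j v k) * g k)) ⟩
      sumDiv L (λ k → sumFin (λ v → 𝟙 (chain? i j v k) * g k))
    ≈⟨ sumOver-cong (divisors L) (λ k _ → trans (sumFin-cong (λ _ → *-comm _ _))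
                                            (trans (sumFin-*ˡ (g k) _) (trans (*-congˡ (countChains i j k)) (*-comm _ _)))) ⟩
      sumDiv L (λ k → 𝟙 (lcm (x i) (x j) ∣? k) * g k)
    ≈⟨ mobiusInversion f L (lcm (x i) (x j)) L≥1 (lcm-least (∣lcmAll x i) (∣lcmAll x j)) ⟩
      f (lcm (x i) (x j))
    ∎)
    where
    termAsSum : ∀ v → E i v * (h v * E j v) ≈ sumDiv L (λ k → 𝟙 (chain? i j v k) * g k)
    termAsSum v =
      begin
        E i v * (h v * E j v)
      ≈⟨ *-congˡ (trans (*-comm _ _) (*-congˡ (h-as-sum v))) ⟩
        E i v * (E j v * sumDiv L (λ k → 𝟙 (isTop? v k) * g k))
      ≈⟨ trans (*-congˡ (sym (sumOver-*ˡ (divisors L) _ _))) (sym (sumOver-*ˡ (divisors L) _ _)) ⟩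
        sumDiv L (λ k → E i v * (E j v * (𝟙 (isTop? v k) * g k)))
      ≈⟨ sumOver-cong (divisors L) (λ k _ → sym (bracketsCombine k)) ⟩
        sumDiv L (λ k → 𝟙 (chain? i j v k) * g k)
      ∎
      where
      bracketsCombine : ∀ k → 𝟙 (chain? i j v k) * g k ≈ E i v * (E j v * (𝟙 (isTop? v k) * g k))
      bracketsCombine k =
        trans (*-congʳ (trans (𝟙-× (x i ∣? x v) _) (*-congˡ (𝟙-× (x j ∣? x v) (isTop? v k)))))
              (trans (*-assoc _ _ _) (*-congˡ (*-assoc _ _ _)))

  -- det [S]_f = det (E B) with B_vj = h_v E_jv lower triangular, so det [S]_f = Π h_v.
  lcmMatrix-det : det (λ i j → f (lcm (x i) (x j))) ≈ ∏ h
  lcmMatrix-det =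
    begin
      det (λ i j → f (lcm (x i) (x j)))             ≈⟨ det-cong factorisation ⟩
      det (λ i j → sumFin (λ v → E i v * B v j))    ≈⟨ det-unitriangular E B E-below E-diagonal ⟩
      det B                                         ≈⟨ det-lowerTriangular B (λ v j v<j → trans (*-congˡ (E-below j v v<j)) (zeroʳ _)) ⟩
      ∏ (λ v → h v * E v v)                         ≈⟨ ∏-cong (λ v → trans (*-congˡ (E-diagonal v)) (*-identityʳ _)) ⟩
      ∏ h                                           ∎
    where
    B : Matrix n
    B v j = h v * E j v

corollary4p7 : ∀ {c ℓ : Level} (R : CommutativeRing c ℓ) (n : ℕ) (x : Fin n → ℕ) →
  (∀ i → 1 ≤ x i) →
  (∀ i j → x i ≡ x j → i ≡ j) →
  LCMClosed x →
  (∀ i j → x i ∣ x j → i Data.Fin.≤ j) →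
  (f : ℕ → CommutativeRing.Carrier R) →
  let open CommutativeRing R using (_≈_)
      open Arith R
  in det (λ i j → f (lcm (x i) (x j)))
     ≈ ∏ (λ v → sumL (map (λ z → (ζ ⋆ (shift f z · μ)) (lcmAll x ÷ z)) (zsFor x v)))
corollary4p7 R n x positive _ closed ordered f = LCMMatrix.lcmMatrix-det R x positive closed ordered f
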